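{- Let $a,b$ be integers with $a-1>b\ge 1$, let $\varphi(0)=0^a1$, $\varphi(1)=0^b1$, let $u_\beta=\lim_{n\to\infty}\varphi^n(0)$, let $T(w)=0^b1\varphi(w)0^b$, and define $U^{(1)}=0^{a-1}$, $U^{(n)}=T(U^{(n-1)})$, $V^{(1)}=0^b$, $V^{(n)}=T(V^{(n-1)})$ for $n\ge2$. (i) If $b$ is even and $a$ odd: for each $z\in\{\varepsilon,1,0\}$ there is an infinite palindromic branch with center $z$, namely the bidirectional limit of $V^{(2n-1)}$ (center $\varepsilon$), of $V^{(2n)}$ (center $1$), and of $W^{(n)}$ (center $0$), where $W^{(1)}=0$, $W^{(n)}=T(W^{(n-1)})$. For $n\in\mathbb N$, the longest common central factor of the maximal palindrome $U^{(n)}$ and the infinite palindromic branch with the same center is $V^{(n)}$. No maximal palindrome has the same center as the branch $\lim W^{(n)}$. (ii) If $a$ and $b$ are both even: there is an infinite palindromic branch with center $\varepsilon$, the bidirectional limit of $V^{(2n-1)}$, and one with center $1$, the bidirectional limit of $V^{(2n)}$; there is no infinite palindromic branch with center $0$. For $n\ge 2$, the longest common central factor of $U^{(n)}$ and the infinite palindromic branch with the same center is $V^{(n-1)}$. (iii) If $b$ is odd and $a$ even: for each $z\in\{0,\varepsilon,1\}$ there is an infinite palindromic branch with center $z$, namely the bidirectional limit of $V^{(3n-2)}$ (center $0$), of $V^{(3n-1)}$ (center $\varepsilon$), and of $V^{(3n)}$ (center $1$). For $n\in\mathbb N$, the longest common central factor of $U^{(n)}$ and the infinite palindromic branch with the same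 center is $V^{(n)}$. (iv) If $a$ and $b$ are both odd: there is an infinite palindromic branch with center $0$, the bidirectional limit of the $V^{(n)}$, $n\in\mathbb N$; there is no infinite palindromic branch with center $\varepsilon$ nor with center $1$. For $n\ge 3$, the longest common central factor of $U^{(n)}$ and the infinite palindromic branch is $V^{(n-2)}$.
   Context: $\mathbb N$ denotes the positive integers. A palindrome is a word equal to its reversal $\overline w$. A palindrome $q$ is a central factor of a palindrome $p$ if $p=wq\overline w$ for some finite factor $w$ of $u_\beta$. The center of an odd-length palindrome $p=wz\overline w$ is the letter $z$; that of an even-length palindrome is the empty word $\varepsilon$. The words $U^{(n)}$ are exactly the maximal palindromes of $u_\beta$ (palindromic factors $p$ with neither $0p0$ nor $1p1$ a factor). For $v=v_1v_2\cdots$ right-infinite over $\{0,1\}$, $\overline v=\cdots v_2v_1$, and $z\in\{\varepsilon,0,1\}$: if $v_n\cdots v_1zv_1\cdots v_n$ is a factor of $u_\beta$ for every $n$, then $\overline vzv$ is an infinite palindromic branch with center $z$, and these palindromes are its central factors. If $(p_n)$ is a sequence of palindromic factors with the same center $z$, each a central factor of the next, with lengths tending to infinity, its bidirectional limit is the unique bidirectional word $\overline v z v$ having every $p_n$ as a central factor. -}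

module Defs where

open import Data.Nat using (ℕ; zero; suc; _+_; _*_; _∸_; _≤_; _/_; _%_)
open import Data.List using (List; []; _∷_; _++_; replicate; reverse; concatMap; applyUpTo; length; take; drop)
open import Data.Product using (Σ; ∃; _×_)
open import Relation.Binary.PropositionalEquality using (_≡_)

data Bit : Set where
  b0 b1 : Bit

Word : Set
Word = List Bit

φ₁ : ℕ → ℕ → Bit → Word
φ₁ a b b0 = replicate a b0 ++ b1 ∷ []
φ₁ a b b1 = replicate b b0 ++ b1 ∷ []

φ : ℕ → ℕ → Word → Word
φ a b = concatMap (φ₁ a b)

φ^ : ℕ → ℕ → ℕ → Word → Word
φ^ a b zero    w = w
φ^ a b (suc n) w = φ a b (φ^ a b n w)

-- n-th letter (0-based) of a finite word, default b0 when out of range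
nth : Word → ℕ → Bit
nth []      _       = b0
nth (x ∷ w) zero    = x
nth (x ∷ w) (suc i) = nth w i

-- u_β = lim φ^n(0), as a function ℕ → Bit (0-based positions).
-- φ^n(0) is a prefix of φ^(n+1)(0) and |φ^(i+1)(0)| > i, so the i-th letter
-- of the limit is the i-th letter of φ^(i+1)(0).
u : ℕ → ℕ → ℕ → Bit
u a b i = nth (φ^ a b (suc i) (b0 ∷ [])) i

-- first n letters of a right-infinite word v = v₁ v₂ … (v 0 = v₁)
pref : (ℕ → Bit) → ℕ → Word
pref v n = applyUpTo v n

Factor : ℕ → ℕ → Word → Set
Factor a b w = ∃ λ i → pref (λ k → u a b (i + k)) (length w) ≡ w

Palindrome : Word → Set
Palindrome w = reverse w ≡ w

MaximalPalindrome : ℕ → ℕ → Word → Set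
MaximalPalindrome a b p =
  Factor a b p × Palindrome p
  × (Factor a b (b0 ∷ p ++ b0 ∷ []) → Data.Empty.⊥)
  × (Factor a b (b1 ∷ p ++ b1 ∷ []) → Data.Empty.⊥)
  where import Data.Empty

T : ℕ → ℕ → Word → Word
T a b w = replicate b b0 ++ b1 ∷ φ a b w ++ replicate b b0

-- U^(1) = 0^(a-1), U^(n) = T(U^(n-1)); index 0 unused (set to [])
U : ℕ → ℕ → ℕ → Word
U a b zero          = []
U a b (suc zero)    = replicate (a ∸ 1) b0
U a b (suc (suc n)) = T a b (U a b (suc n))

-- V^(1) = 0^b, V^(n) = T(V^(n-1)); index 0 unused
V : ℕ → ℕ → ℕ → Word
V a b zero          = []
V a b (suc zero)    = replicate b b0
V a b (suc (suc n)) = T a b (V a b (suc n))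

-- W^(1) = 0, W^(n) = T(W^(n-1)); index 0 unused
W : ℕ → ℕ → ℕ → Word
W a b zero          = []
W a b (suc zero)    = b0 ∷ []
W a b (suc (suc n)) = T a b (W a b (suc n))

-- Centers are represented as words of length ≤ 1:
-- ε = [], and the letter z = z ∷ [].
-- Center of a (palindromic) word: middle letter if odd length, else ε.
center : Word → Word
center p = take (length p % 2) (drop (length p / 2) p)

CentralFactor : Word → Word → Set
CentralFactor p q = ∃ λ w → p ≡ w ++ q ++ reverse w

-- The bidirectional word  v̄ z v  (v = v₁ v₂ …, z a center word) is an
-- infinite palindromic branch: v_n⋯v_1 z v_1⋯v_n is a factor for every n.
IsBranch : ℕ → ℕ → Word → (ℕ → Bit) → Set
IsBranch a b z v = ∀ n → Factor a b (reverse (pref v n) ++ z ++ pref v n)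

CentralFactorBi : Word → (ℕ → Bit) → Word → Set
CentralFactorBi z v q = ∃ λ k → q ≡ reverse (pref v k) ++ z ++ pref v k

-- v̄ z v is the bidirectional limit of the sequence s 0, s 1, …:
-- every s n is a central factor of v̄ z v and the lengths are unbounded
-- (this forces the s n to share center z, to be nested as central factors,
-- and makes v̄ z v unique).
IsBidiLimit : (ℕ → Word) → Word → (ℕ → Bit) → Set
IsBidiLimit s z v = (∀ n → CentralFactorBi z v (s n)) × (∀ m → ∃ λ n → m ≤ length (s n))

LongestCommonCentral : Word → Word → (ℕ → Bit) → Word → Set
LongestCommonCentral p z v q =
  CentralFactor p q × CentralFactorBi z v q
  × (∀ r → CentralFactor p r → CentralFactorBi z v r → length r ≤ length q)

-- A palindrome with center z ∈ {ε, 0, 1} and half h is the mirror word h̄ z h. Write a = 2 qa + |za| and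
-- b = 2 qb + |zb| with za, zb ∈ {ε, 0}. Then T maps h̄ z h to a palindrome whose center depends only on z
-- (ε ↦ 1, 0 ↦ za, 1 ↦ zb) and whose half depends monotonically on h: if h′ continues h with the letter c,
-- so do the new halves. Along the T-orbit of V^(1) = 0^b the centers are periodic, and when P steps continue
-- the half with a letter c′, each residue class mod P is a chain of nested palindromic factors whose limit is
-- a branch. The half of U^(1) = 0^(a-1), or of one of its first T-images, continues that of V^(1) with a
-- letter c ≠ c′, and this difference persists, so V^(n) is the longest common central factor. The negative
-- statements come from desubstitution: two consecutive 1s of u_β are separated by a or b zeros, so a
-- palindrome with center 0 (resp. ε) containing a 1 needs a gap of odd (resp. even) length. In case (i) every
-- 0-centered palindromic factor is a central factor of some W^(n), hence extends inside W^(n+1).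

{-# OPTIONS --safe #-}
module Submission where

open import Defs
open import Data.Nat using (ℕ; suc; _+_; _*_; _∸_; _≤_; _<_)
open import Data.Nat.Divisibility using (_∣_)
open import Data.List using (List; []; _∷_)
open import Data.Product using (Σ; ∃; _×_)
open import Data.Sum using (_⊎_)
open import Relation.Nullary using (¬_)
open import Relation.Binary.PropositionalEquality using (_≡_; _≢_)

open import Data.Nat using (zero; z≤n; s≤s; s≤s⁻¹; s<s⁻¹; _≤?_; _<?_; NonZero; _≤′_; ≤′-refl; ≤′-step)
open import Data.Nat.Properties
open import Data.Nat.DivMod using (_/_; _%_; [m+kn]%n≡m%n; +-distrib-/-∣ʳ; m*n/n≡m; m≡m%n+[m/n]*n; m%n<n)
open import Data.Nat.Divisibility using (divides)
open import Data.List using (_++_; _∷ʳ_; replicate; reverse; length; take; drop)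
open import Data.List.Properties
open import Data.List.Reverse using (reverseView; Reverse)
open import Data.Product using (_,_; proj₁; proj₂; ∃₂; map; map₂)
open import Data.Sum using (inj₁; inj₂)
open import Data.Empty using (⊥; ⊥-elim)
open import Relation.Nullary using (yes; no; Dec)
open import Relation.Binary.PropositionalEquality
  using (refl; sym; trans; cong; cong₂; subst; subst₂; module ≡-Reasoning)
open import Data.Nat.Tactic.RingSolver using (solve-∀)
open import Function using (_∘_)
open import Data.Nat.GeneralisedArithmetic using (fold; fold-+)
open import Algebra.Solver.Monoid (++-monoid Bit) using (solve; _⊕_; _⊜_)

++-cancel-≡length : ∀ {A : Set} (xs ys : List A) {zs ws} → length xs ≡ length ys →
                    xs ++ zs ≡ ys ++ ws → xs ≡ ys × zs ≡ ws
++-cancel-≡length []       []       _ e = refl , e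
++-cancel-≡length (x ∷ xs) (y ∷ ys) l e with refl , e′ ← ∷-injective e
  with refl , e″ ← ++-cancel-≡length xs ys (suc-injective l) e′ = refl , e″

length-∷ʳ : ∀ {A : Set} (xs : List A) x → length (xs ∷ʳ x) ≡ suc (length xs)
length-∷ʳ xs x = trans (length-++ xs) (+-comm (length xs) 1)

reverse-∷-∷ʳ : ∀ {A : Set} x (xs : List A) y → reverse (x ∷ xs ∷ʳ y) ≡ y ∷ reverse xs ∷ʳ x
reverse-∷-∷ʳ x xs y = trans (unfold-reverse x (xs ∷ʳ y)) (cong (_∷ʳ x) (reverse-++ xs (y ∷ [])))

drop-length-++ : ∀ {A : Set} (xs ys : List A) → drop (length xs) (xs ++ ys) ≡ ys
drop-length-++ []       ys = refl
drop-length-++ (x ∷ xs) ys = drop-length-++ xs ys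

∷ʳ-nonempty : ∀ {A : Set} (xs : List A) x → ∃₂ λ y ys → xs ∷ʳ x ≡ y ∷ ys
∷ʳ-nonempty []       x = x , [] , refl
∷ʳ-nonempty (y ∷ xs) x = y , xs ∷ʳ x , refl

zeros : ℕ → Word
zeros n = replicate n b0

zeros-+ : ∀ m n → zeros (m + n) ≡ zeros m ++ zeros n
zeros-+ zero    n = refl
zeros-+ (suc m) n = cong (b0 ∷_) (zeros-+ m n)

zeros-comm : ∀ m n → zeros m ++ zeros n ≡ zeros n ++ zeros m
zeros-comm m n = trans (sym (zeros-+ m n)) (trans (cong zeros (+-comm m n)) (zeros-+ n m))

reverse-zeros : ∀ n → reverse (zeros n) ≡ zeros n
reverse-zeros zero    = refl
reverse-zeros (suc n) = begin
  reverse (b0 ∷ zeros n)  ≡⟨ unfold-reverse b0 (zeros n) ⟩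
  reverse (zeros n) ∷ʳ b0 ≡⟨ cong (_∷ʳ b0) (reverse-zeros n) ⟩
  zeros n ++ zeros 1      ≡⟨ zeros-comm n 1 ⟩
  b0 ∷ zeros n            ∎
  where open ≡-Reasoning

zeros-1-split : ∀ k S P R → zeros k ++ b1 ∷ S ≡ P ++ R →
    (∃ λ j → j ≤ k × P ≡ zeros j × R ≡ zeros (k ∸ j) ++ b1 ∷ S)
  ⊎ (∃ λ P′ → P ≡ zeros k ++ b1 ∷ P′ × S ≡ P′ ++ R)
zeros-1-split k       S []      R e = inj₁ (0 , z≤n , refl , sym e)
zeros-1-split zero    S (p ∷ P) R e with refl , e′ ← ∷-injective e = inj₂ (P , refl , e′)
zeros-1-split (suc k) S (p ∷ P) R e with refl , e′ ← ∷-injective e with zeros-1-split k S P R e′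
... | inj₁ (j , j≤k , refl , eR) = inj₁ (suc j , s≤s j≤k , refl , eR)
... | inj₂ (P′ , refl , eS)      = inj₂ (P′ , refl , eS)

zeros-prefix-≤ : ∀ k m Q S → zeros k ++ Q ≡ zeros m ++ b1 ∷ S → k ≤ m
zeros-prefix-≤ zero    m       Q S e = z≤n
zeros-prefix-≤ (suc k) (suc m) Q S e = s≤s (zeros-prefix-≤ k m Q S (proj₂ (∷-injective e)))

zeros-1-injective : ∀ m n S S′ → zeros m ++ b1 ∷ S ≡ zeros n ++ b1 ∷ S′ → m ≡ n × S ≡ S′
zeros-1-injective zero    zero    S S′ e = refl , proj₂ (∷-injective e)
zeros-1-injective (suc m) (suc n) S S′ e with refl , e′ ← zeros-1-injective m n S S′ (proj₂ (∷-injective e)) = refl , e′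

zeros-1-nonempty : ∀ k S → zeros k ++ b1 ∷ S ≢ []
zeros-1-nonempty zero    S ()
zeros-1-nonempty (suc k) S ()

split-leading-zeros : ∀ h → h ≡ zeros (length h) ⊎ ∃₂ λ j h′ → h ≡ zeros j ++ b1 ∷ h′
split-leading-zeros []       = inj₁ refl
split-leading-zeros (b1 ∷ h) = inj₂ (0 , h , refl)
split-leading-zeros (b0 ∷ h) with split-leading-zeros h
... | inj₁ e             = inj₁ (cong (b0 ∷_) e)
... | inj₂ (j , h′ , e)  = inj₂ (suc j , h′ , cong (b0 ∷_) e)

split-trailing-zeros : ∀ h → ∃₂ λ Y i → h ≡ Y ++ zeros i × (Y ≡ [] ⊎ ∃ λ Y′ → Y ≡ Y′ ∷ʳ b1)
split-trailing-zeros []      = [] , 0 , refl , inj₁ refl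
split-trailing-zeros (x ∷ h) with split-trailing-zeros h
split-trailing-zeros (b0 ∷ h) | []    , i , refl , _ = [] , suc i , refl , inj₁ refl
split-trailing-zeros (b1 ∷ h) | []    , i , refl , _ = b1 ∷ [] , i , refl , inj₂ ([] , refl)
split-trailing-zeros (x ∷ h)  | y ∷ Y , i , refl , inj₂ (Y′ , e) = x ∷ y ∷ Y , i , refl , inj₂ (x ∷ Y′ , cong (x ∷_) e)

infix 4 _⊑_ _⊏[_]_

_⊑_ : Word → Word → Set
x ⊑ y = ∃ λ s → y ≡ x ++ s

_⊏[_]_ : Word → Bit → Word → Set
x ⊏[ c ] y = ∃ λ s → y ≡ x ++ c ∷ s

⊑-refl : ∀ x → x ⊑ x
⊑-refl x = [] , sym (++-identityʳ x)

⊑-trans : ∀ {x y z} → x ⊑ y → y ⊑ z → x ⊑ z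
⊑-trans {x} (s , refl) (t , refl) = s ++ t , ++-assoc x s t

⊏⇒⊑ : ∀ {c x y} → x ⊏[ c ] y → x ⊑ y
⊏⇒⊑ {c} (s , e) = c ∷ s , e

⊑-++ˡ : ∀ w {x y} → x ⊑ y → w ++ x ⊑ w ++ y
⊑-++ˡ w {x} (s , refl) = s , sym (++-assoc w x s)

⊏-++ˡ : ∀ w {c x y} → x ⊏[ c ] y → w ++ x ⊏[ c ] w ++ y
⊏-++ˡ w {c} {x} (s , refl) = s , sym (++-assoc w x (c ∷ s))

⊏-++ʳ : ∀ {c x y} → x ⊏[ c ] y → ∀ w → x ⊏[ c ] y ++ w
⊏-++ʳ {c} {x} (s , refl) w = s ++ w , ++-assoc x (c ∷ s) w

⊑⇒length≤ : ∀ {x y} → x ⊑ y → length x ≤ length y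
⊑⇒length≤ {x} (s , refl) = length-++-≤ˡ x

⊏⇒length< : ∀ {c x y} → x ⊏[ c ] y → length x < length y
⊏⇒length< {c} {x} (s , refl) = ≤-trans (s≤s (length-++-≤ˡ x)) (≤-reflexive (sym (length-++-sucʳ x c s)))

⊑∧length<⇒⊏ : ∀ {x y} → x ⊑ y → length x < length y → ∃ λ c → x ⊏[ c ] y
⊑∧length<⇒⊏ {x} ([]    , refl) lt = ⊥-elim (<-irrefl (cong length (sym (++-identityʳ x))) lt)
⊑∧length<⇒⊏ {x} (c ∷ s , refl) _  = c , s , refl

∷ʳ⊑⇒⊏ : ∀ {c x y} → x ∷ʳ c ⊑ y → x ⊏[ c ] y
∷ʳ⊑⇒⊏ {c} {x} (s , refl) = s , ++-assoc x (c ∷ []) s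

⊏⇒∷ʳ⊑ : ∀ {c x y} → x ⊏[ c ] y → x ∷ʳ c ⊑ y
⊏⇒∷ʳ⊑ {c} {x} (s , refl) = s , sym (++-assoc x (c ∷ []) s)

⊏-letter-unique : ∀ {c c′ x y} → x ⊏[ c ] y → x ⊏[ c′ ] y → c ≡ c′
⊏-letter-unique {x = x} (s , refl) (t , e) = proj₁ (∷-injective (++-cancelˡ x _ _ e))

⊑∧⊏⇒≡∷ʳ : ∀ {c x y h} → x ⊑ y → h ⊏[ c ] y → length x ≡ suc (length h) → x ≡ h ∷ʳ c
⊑∧⊏⇒≡∷ʳ {c} {x} {y} {h} (s , e₁) (t , e₂) l = proj₁ (++-cancel-≡length x (h ∷ʳ c)
  (trans l (sym (length-∷ʳ h c))) (trans (sym e₁) (trans e₂ (sym (++-assoc h (c ∷ []) t)))))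

zeros-<⇒⊏ : ∀ {q p} → q < p → zeros q ⊏[ b0 ] zeros p
zeros-<⇒⊏ {q} {p} q<p = zeros (p ∸ suc q) , (begin
  zeros p                       ≡⟨ cong zeros (sym (trans (+-suc q (p ∸ suc q)) (m+[n∸m]≡n q<p))) ⟩
  zeros (q + suc (p ∸ suc q))   ≡⟨ zeros-+ q (suc (p ∸ suc q)) ⟩
  zeros q ++ b0 ∷ zeros (p ∸ suc q) ∎)
  where open ≡-Reasoning

zeros-≤⇒⊑ : ∀ {q p} → q ≤ p → ∀ w → zeros q ⊑ zeros p ++ w
zeros-≤⇒⊑ {q} {p} q≤p w = zeros (p ∸ q) ++ w , (begin
  zeros p ++ w                  ≡⟨ cong (λ n → zeros n ++ w) (sym (m+[n∸m]≡n q≤p)) ⟩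
  zeros (q + (p ∸ q)) ++ w      ≡⟨ cong (_++ w) (zeros-+ q (p ∸ q)) ⟩
  (zeros q ++ zeros (p ∸ q)) ++ w ≡⟨ ++-assoc (zeros q) _ w ⟩
  zeros q ++ zeros (p ∸ q) ++ w ∎)
  where open ≡-Reasoning

chain-mono : (s : ℕ → Word) → (∀ n → s n ⊑ s (suc n)) → ∀ {n m} → n ≤ m → s n ⊑ s m
chain-mono s chain n≤m = go (≤⇒≤′ n≤m)
  where
  go : ∀ {n m} → n ≤′ m → s n ⊑ s m
  go ≤′-refl        = ⊑-refl _
  go (≤′-step n≤′m) = ⊑-trans (go n≤′m) (chain _)

Infix : Word → Word → Set
Infix w x = ∃₂ λ P Q → x ≡ P ++ w ++ Q

infix-trans : ∀ {w x y} → Infix w x → Infix x y → Infix w y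
infix-trans {w} (P , Q , refl) (P′ , Q′ , refl) = P′ ++ P , Q ++ Q′ ,
  solve 5 (λ P′ P w Q Q′ → P′ ⊕ (P ⊕ w ⊕ Q) ⊕ Q′ ⊜ (P′ ⊕ P) ⊕ w ⊕ Q ⊕ Q′) refl P′ P w Q Q′

*2≡double : ∀ q → q * 2 ≡ q + q
*2≡double q = trans (*-comm q 2) (cong (q +_) (+-identityʳ q))

even⇒double : ∀ {n} → 2 ∣ n → ∃ λ q → n ≡ q + q
even⇒double (divides q refl) = q , *2≡double q

double-or-double+1 : ∀ n → ∃ λ q → n ≡ q + q ⊎ n ≡ q + suc q
double-or-double+1 zero    = 0 , inj₁ refl
double-or-double+1 (suc n) with double-or-double+1 n
... | q , inj₁ refl = q , inj₂ (sym (+-suc q q))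
... | q , inj₂ refl = suc q , inj₁ refl

odd⇒double+1 : ∀ {n} → ¬ 2 ∣ n → ∃ λ q → n ≡ q + suc q
odd⇒double+1 {n} odd with double-or-double+1 n
... | q , inj₁ n≡ = ⊥-elim (odd (divides q (trans n≡ (sym (*2≡double q)))))
... | q , inj₂ n≡ = q , n≡

+1<⇒< : ∀ {m n} → m + 1 < n → m < n
+1<⇒< {m} = <-trans (m<m+n m (s≤s z≤n))

double-<-cancel : ∀ {m n} → m + m < n + n → m < n
double-<-cancel {m} {n} lt with m <? n
... | yes m<n = m<n
... | no  m≮n = ⊥-elim (<⇒≱ lt (+-mono-≤ (≮⇒≥ m≮n) (≮⇒≥ m≮n)))

double+1-≤-cancel : ∀ {m n} → m + suc m ≤ n + suc n → m ≤ n
double+1-≤-cancel {m} {n} le with m ≤? n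
... | yes m≤n = m≤n
... | no  m≰n = ⊥-elim (<⇒≱ (+-mono-< (≰⇒> m≰n) (s≤s (≰⇒> m≰n))) le)

double+1-injective : ∀ {m n} → m + suc m ≡ n + suc n → m ≡ n
double+1-injective e = ≤-antisym (double+1-≤-cancel (≤-reflexive e)) (double+1-≤-cancel (≤-reflexive (sym e)))

double≢double+1 : ∀ m n → m + m ≢ n + suc n
double≢double+1 zero    zero    ()
double≢double+1 (suc m) zero    e with () ← trans (sym (+-suc m m)) (suc-injective e)
double≢double+1 (suc m) (suc n) e =
  double≢double+1 m n (suc-injective (trans (sym (+-suc m m)) (trans (suc-injective e) (+-suc n (suc n)))))

-- Palindromes

data Center : Set where
  cε c0 c1 : Center

word : Center → Word
word cε = []
word c0 = b0 ∷ []
word c1 = b1 ∷ []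

word-injective : ∀ {z z′} → word z ≡ word z′ → z ≡ z′
word-injective {cε} {cε} _ = refl
word-injective {c0} {c0} _ = refl
word-injective {c1} {c1} _ = refl

letter : Bit → Center
letter b0 = c0
letter b1 = c1

word-letter : ∀ x → word (letter x) ≡ x ∷ []
word-letter b0 = refl
word-letter b1 = refl

mirror : Center → Word → Word
mirror z h = reverse h ++ word z ++ h

length-mirror : ∀ z h → length (mirror z h) ≡ length (word z) + length h * 2
length-mirror z h = begin
  length (reverse h ++ word z ++ h)         ≡⟨ length-++ (reverse h) ⟩
  length (reverse h) + length (word z ++ h) ≡⟨ cong₂ _+_ (length-reverse h) (length-++ (word z)) ⟩
  L + (length (word z) + L)                 ≡⟨ +-comm L _ ⟩
  (length (word z) + L) + L                 ≡⟨ +-assoc (length (word z)) L L ⟩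
  length (word z) + (L + L)                 ≡⟨ cong (length (word z) +_) (*2≡double L) ⟨
  length (word z) + L * 2                   ∎
  where open ≡-Reasoning
        L = length h

length-half≤mirror : ∀ z h → length h ≤ length (mirror z h)
length-half≤mirror z h = subst (length h ≤_) (sym (length-mirror z h)) (≤-trans (m≤m*n (length h) 2) (m≤n+m _ _))

mirror-length-mono : ∀ z {h h′} → length h ≤ length h′ → length (mirror z h) ≤ length (mirror z h′)
mirror-length-mono z {h} {h′} le = begin
  length (mirror z h)        ≡⟨ length-mirror z h ⟩
  length (word z) + length h * 2  ≤⟨ +-monoʳ-≤ (length (word z)) (*-monoˡ-≤ 2 le) ⟩
  length (word z) + length h′ * 2 ≡⟨ length-mirror z h′ ⟨
  length (mirror z h′)       ∎
  where open ≤-Reasoning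

center-mirror : ∀ z h → center (mirror z h) ≡ word z
center-mirror z h = begin
  take (length (mirror z h) % 2) (drop (length (mirror z h) / 2) (mirror z h))
    ≡⟨ cong (λ n → take (n % 2) (drop (n / 2) (mirror z h))) (length-mirror z h) ⟩
  take ((length (word z) + L * 2) % 2) (drop ((length (word z) + L * 2) / 2) (mirror z h))
    ≡⟨ cong₂ (λ r q → take r (drop q (mirror z h))) ([m+kn]%n≡m%n (length (word z)) L 2) (half z) ⟩
  take (length (word z) % 2) (drop L (reverse h ++ word z ++ h))
    ≡⟨ cong (λ n → take (length (word z) % 2) (drop n (reverse h ++ word z ++ h))) (sym (length-reverse h)) ⟩
  take (length (word z) % 2) (drop (length (reverse h)) (reverse h ++ word z ++ h))
    ≡⟨ cong (take (length (word z) % 2)) (drop-length-++ (reverse h) (word z ++ h)) ⟩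
  take (length (word z) % 2) (word z ++ h)
    ≡⟨ take-word z ⟩
  word z ∎
  where
  open ≡-Reasoning
  L = length h
  half : ∀ z → (length (word z) + L * 2) / 2 ≡ L
  half z = trans (+-distrib-/-∣ʳ (length (word z)) (divides L refl)) (help z)
    where
    help : ∀ z → length (word z) / 2 + L * 2 / 2 ≡ L
    help cε = m*n/n≡m L 2
    help c0 = m*n/n≡m L 2
    help c1 = m*n/n≡m L 2
  take-word : ∀ z → take (length (word z) % 2) (word z ++ h) ≡ word z
  take-word cε = refl
  take-word c0 = refl
  take-word c1 = refl

mirror-∷ʳ : ∀ z h x → mirror z (h ∷ʳ x) ≡ x ∷ (mirror z h ∷ʳ x)
mirror-∷ʳ z h x = begin
  reverse (h ∷ʳ x) ++ word z ++ h ∷ʳ x   ≡⟨ cong (_++ word z ++ h ∷ʳ x) (reverse-++ h (x ∷ [])) ⟩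
  x ∷ reverse h ++ word z ++ h ∷ʳ x
    ≡⟨ cong (x ∷_) (solve 4 (λ A B C X → A ⊕ B ⊕ C ⊕ X ⊜ (A ⊕ B ⊕ C) ⊕ X) refl (reverse h) (word z) h (x ∷ [])) ⟩
  x ∷ (mirror z h ∷ʳ x)                     ∎
  where open ≡-Reasoning

palindrome⇒mirror′ : ∀ n p → length p ≤ n → Palindrome p → ∃₂ λ z h → p ≡ mirror z h
palindrome⇒mirror′ _ [] _ _ = cε , [] , refl
palindrome⇒mirror′ n (x ∷ p) _ _ with reverseView p
palindrome⇒mirror′ n (x ∷ .[]) _ _ | Reverse.[] = letter x , [] , cong (_++ []) (sym (word-letter x))
palindrome⇒mirror′ (suc n) (x ∷ .(q ∷ʳ y)) (s≤s |p|≤n) pal | q Reverse.∶ _ ∶ʳ y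
  with refl , pal′ ← ∷-injective (trans (sym (reverse-∷-∷ʳ x q y)) pal)
  with z , h , refl ← palindrome⇒mirror′ n q (≤-trans (n≤1+n _) (subst (_≤ n) (length-∷ʳ q y) |p|≤n))
                                          (∷ʳ-injectiveˡ (reverse q) q pal′)
  = z , h ∷ʳ x , sym (mirror-∷ʳ z h x)

palindrome⇒mirror : ∀ p → Palindrome p → ∃₂ λ z h → p ≡ mirror z h
palindrome⇒mirror p = palindrome⇒mirror′ (length p) p ≤-refl

mirror-zeros-ε : ∀ q → mirror cε (zeros q) ≡ zeros (q + q)
mirror-zeros-ε q = trans (cong (_++ zeros q) (reverse-zeros q)) (sym (zeros-+ q q))

mirror-zeros-0 : ∀ q → mirror c0 (zeros q) ≡ zeros (q + suc q)
mirror-zeros-0 q = trans (cong (_++ b0 ∷ zeros q) (reverse-zeros q)) (sym (zeros-+ q (suc q)))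

mirror-zeros-1 : ∀ z j h → mirror z (zeros j ++ b1 ∷ h) ≡ reverse h ++ (b1 ∷ (zeros j ++ word z ++ zeros j) ∷ʳ b1) ++ h
mirror-zeros-1 z j h = begin
  reverse (zeros j ++ b1 ∷ h) ++ word z ++ zeros j ++ b1 ∷ h
    ≡⟨ cong (_++ word z ++ zeros j ++ b1 ∷ h)
         (trans (reverse-++ (zeros j) (b1 ∷ h)) (cong₂ _++_ (unfold-reverse b1 h) (reverse-zeros j))) ⟩
  ((reverse h ∷ʳ b1) ++ zeros j) ++ word z ++ zeros j ++ b1 ∷ h
    ≡⟨ solve 5 (λ R l A B C → ((R ⊕ l) ⊕ A) ⊕ B ⊕ A ⊕ l ⊕ C ⊜ R ⊕ (l ⊕ (A ⊕ B ⊕ A) ⊕ l) ⊕ C) refl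
         (reverse h) (b1 ∷ []) (zeros j) (word z) h ⟩
  reverse h ++ (b1 ∷ (zeros j ++ word z ++ zeros j) ∷ʳ b1) ++ h ∎
  where open ≡-Reasoning

mirror-ε-∷ : ∀ c g → mirror cε (c ∷ g) ≡ reverse g ++ (c ∷ c ∷ []) ++ g
mirror-ε-∷ c g = trans (cong (_++ c ∷ g) (unfold-reverse c g)) (++-assoc (reverse g) (c ∷ []) (c ∷ g))

infix 4.5 _⊲_

record Mirror : Set where
  constructor _⊲_
  field
    mid  : Center
    half : Word
open Mirror

⟦_⟧ : Mirror → Word
⟦ z ⊲ h ⟧ = mirror z h

⊑⇒centralFactor : ∀ z {h h′} → h ⊑ h′ → CentralFactor (mirror z h′) (mirror z h)
⊑⇒centralFactor z {h} (s , refl) = reverse s , (begin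
  reverse (h ++ s) ++ word z ++ h ++ s        ≡⟨ cong (_++ word z ++ h ++ s) (reverse-++ h s) ⟩
  (reverse s ++ reverse h) ++ word z ++ h ++ s
    ≡⟨ solve 5 (λ A B C D E → (A ⊕ B) ⊕ C ⊕ D ⊕ E ⊜ A ⊕ (B ⊕ C ⊕ D) ⊕ E) refl
         (reverse s) (reverse h) (word z) h s ⟩
  reverse s ++ mirror z h ++ s                ≡⟨ cong (λ t → reverse s ++ mirror z h ++ t) (sym (reverse-involutive s)) ⟩
  reverse s ++ mirror z h ++ reverse (reverse s) ∎)
  where open ≡-Reasoning

centralFactor⇒⊑ : ∀ z h′ h → CentralFactor (mirror z h′) (mirror z h) → h ⊑ h′
centralFactor⇒⊑ z h′ h (w , e) =
  reverse w , proj₂ (++-cancel-≡length (reverse h′ ++ word z) (w ++ reverse h ++ word z) left-lengths split)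
  where
  open ≡-Reasoning
  split : (reverse h′ ++ word z) ++ h′ ≡ (w ++ reverse h ++ word z) ++ h ++ reverse w
  split = trans (++-assoc (reverse h′) (word z) h′) (trans e
    (solve 5 (λ A B C D E → A ⊕ (B ⊕ C ⊕ D) ⊕ E ⊜ (A ⊕ B ⊕ C) ⊕ D ⊕ E) refl w (reverse h) (word z) h (reverse w)))
  lz = length (word z)
  lw = length w
  lh = length h
  twice : lz + length h′ * 2 ≡ lz + (lw + lh) * 2
  twice = begin
    lz + length h′ * 2                         ≡⟨ sym (length-mirror z h′) ⟩
    length (mirror z h′)                      ≡⟨ cong length e ⟩
    length (w ++ mirror z h ++ reverse w)     ≡⟨ length-++ w ⟩
    lw + length (mirror z h ++ reverse w)      ≡⟨ cong (lw +_) (length-++ (mirror z h)) ⟩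
    lw + (length (mirror z h) + length (reverse w)) ≡⟨ cong₂ (λ m n → lw + (m + n)) (length-mirror z h) (length-reverse w) ⟩
    lw + ((lz + lh * 2) + lw)                ≡⟨ rearrange lw lz lh ⟩
    lz + (lw + lh) * 2                       ∎
    where
    rearrange : ∀ lw lz lh → lw + ((lz + lh * 2) + lw) ≡ lz + (lw + lh) * 2
    rearrange = solve-∀
  length-h′ : length h′ ≡ lw + lh
  length-h′ = *-cancelʳ-≡ (length h′) (lw + lh) 2 (+-cancelˡ-≡ lz _ _ twice)
  left-lengths : length (reverse h′ ++ word z) ≡ length (w ++ reverse h ++ word z)
  left-lengths = begin
    length (reverse h′ ++ word z)             ≡⟨ length-++ (reverse h′) ⟩
    length (reverse h′) + lz                   ≡⟨ cong (_+ lz) (trans (length-reverse h′) length-h′) ⟩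
    (lw + lh) + lz                               ≡⟨ +-assoc lw lh lz ⟩
    lw + (lh + lz)                               ≡⟨ cong (lw +_) (cong (_+ lz) (sym (length-reverse h))) ⟩
    lw + (length (reverse h) + lz)              ≡⟨ cong (lw +_) (sym (length-++ (reverse h))) ⟩
    lw + length (reverse h ++ word z)          ≡⟨ sym (length-++ w) ⟩
    length (w ++ reverse h ++ word z)         ∎

centralFactor⇒infix : ∀ {p q} → CentralFactor p q → Infix q p
centralFactor⇒infix (w , e) = w , reverse w , e

half-infix : ∀ z h → Infix h (mirror z h)
half-infix z h = reverse h ++ word z , [] ,
  trans (sym (++-assoc (reverse h) (word z) h)) (cong ((reverse h ++ word z) ++_) (sym (++-identityʳ h)))

maximal⇒¬extends : ∀ {a b p} → MaximalPalindrome a b p → ∀ c → ¬ Factor a b (c ∷ p ∷ʳ c)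
maximal⇒¬extends (_ , _ , no0 , _) b0 = no0
maximal⇒¬extends (_ , _ , _ , no1) b1 = no1

-- Infinite words

nth-++ˡ : ∀ (x y : Word) {i} → i < length x → nth (x ++ y) i ≡ nth x i
nth-++ˡ (c ∷ x) y {zero}  _         = refl
nth-++ˡ (c ∷ x) y {suc i} (s≤s i<) = nth-++ˡ x y i<

nth-++ʳ : ∀ (x y : Word) k → nth (x ++ y) (length x + k) ≡ nth y k
nth-++ʳ []      y k = refl
nth-++ʳ (c ∷ x) y k = nth-++ʳ x y k

nth-⊑ : ∀ {x y} i → x ⊑ y → i < length x → nth y i ≡ nth x i
nth-⊑ {x} i (s , refl) = nth-++ˡ x s

pref-cong : ∀ n {f g : ℕ → Bit} → (∀ k → k < n → f k ≡ g k) → pref f n ≡ pref g n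
pref-cong zero    _  = refl
pref-cong (suc n) eq = cong₂ _∷_ (eq 0 (s≤s z≤n)) (pref-cong n (λ k k<n → eq (suc k) (s≤s k<n)))

pref-nth-++ : ∀ (w y : Word) → pref (nth (w ++ y)) (length w) ≡ w
pref-nth-++ []      y = refl
pref-nth-++ (x ∷ w) y = cong (x ∷_) (pref-nth-++ w y)

pref-⊑ : ∀ (f : ℕ → Bit) {n m} → n ≤ m → pref f n ⊑ pref f m
pref-⊑ f {zero}  {m}     _         = pref f m , refl
pref-⊑ f {suc n} {suc m} (s≤s n≤m) with s , e ← pref-⊑ (λ k → f (suc k)) n≤m = s , cong (f 0 ∷_) e

module PrefixLimit (s : ℕ → Word) (chain : ∀ n → s n ⊑ s (suc n)) (grows : ∀ n → n ≤ length (s n)) where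

  limit : ℕ → Bit
  limit k = nth (s (suc k)) k

  nth-limit : ∀ n k → k < length (s n) → limit k ≡ nth (s n) k
  nth-limit n k k<|sn| with ≤-total n (suc k)
  ... | inj₁ n≤1+k = nth-⊑ k (chain-mono s chain n≤1+k) k<|sn|
  ... | inj₂ 1+k≤n = sym (nth-⊑ k (chain-mono s chain 1+k≤n) (grows (suc k)))

  pref-limit : ∀ n → pref limit (length (s n)) ≡ s n
  pref-limit n = begin
    pref limit (length (s n))           ≡⟨ pref-cong (length (s n)) (nth-limit n) ⟩
    pref (nth (s n)) (length (s n))     ≡⟨ cong (λ w → pref (nth w) (length (s n))) (sym (++-identityʳ (s n))) ⟩
    pref (nth (s n ++ [])) (length (s n)) ≡⟨ pref-nth-++ (s n) [] ⟩
    s n                                 ∎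
    where open ≡-Reasoning

  pref-limit-⊑ : ∀ n {k} → k ≤ length (s n) → pref limit k ⊑ s n
  pref-limit-⊑ n k≤ = subst (pref limit _ ⊑_) (pref-limit n) (pref-⊑ limit k≤)

IsBidiLimit-cong : ∀ {s s′ z v} → (∀ n → s n ≡ s′ n) → IsBidiLimit s z v → IsBidiLimit s′ z v
IsBidiLimit-cong {z = z} {v} eq (central , long) =
    (λ n → subst (CentralFactorBi z v) (eq n) (central n))
  , (λ m → let n , m≤ = long m in n , subst (λ w → m ≤ length w) (eq n) m≤)

longestCommonCentral-mirror : ∀ z (v : ℕ → Bit) {c c′ hV hU} → c ≢ c′ → hV ⊏[ c ] hU →
  pref v (suc (length hV)) ≡ hV ∷ʳ c′ → LongestCommonCentral (mirror z hU) (word z) v (mirror z hV)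
longestCommonCentral-mirror z v {c} {c′} {hV} {hU} c≢c′ hV⊏hU v-next =
  ⊑⇒centralFactor z (⊏⇒⊑ hV⊏hU) , (length hV , cong (mirror z) (sym pref-hV)) , longest
  where
  pref-hV : pref v (length hV) ≡ hV
  pref-hV with s , e ← pref-⊑ v (n≤1+n (length hV)) =
    proj₁ (++-cancel-≡length (pref v (length hV)) hV (length-applyUpTo v _) (trans (sym e) v-next))
  longest : ∀ r → CentralFactor (mirror z hU) r → CentralFactorBi (word z) v r → length r ≤ length (mirror z hV)
  longest _ cf (k , refl) with k ≤? length hV
  ... | yes k≤ = mirror-length-mono z {pref v k} {hV} (subst (_≤ length hV) (sym (length-applyUpTo v k)) k≤)
  ... | no k≰ = ⊥-elim (c≢c′ (⊏-letter-unique hV⊏hU (∷ʳ⊑⇒⊏ (subst (_⊑ hU) v-next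
                  (⊑-trans (pref-⊑ v (≰⇒> k≰)) (centralFactor⇒⊑ z hU (pref v k) cf))))))

-- The substitution φ

module Substitution (a b : ℕ) (b<a : b < a) where

  run : Bit → ℕ
  run b0 = a
  run b1 = b

  run≤a : ∀ c → run c ≤ a
  run≤a b0 = ≤-refl
  run≤a b1 = <⇒≤ b<a

  run-injective : ∀ {x c} → run x ≡ run c → x ≡ c
  run-injective {b0} {b0} _ = refl
  run-injective {b1} {b1} _ = refl
  run-injective {b0} {b1} a≡b = ⊥-elim (<-irrefl (sym a≡b) b<a)
  run-injective {b1} {b0} b≡a = ⊥-elim (<-irrefl b≡a b<a)

  d : ℕ
  d = a ∸ suc b

  zeros-a : zeros a ≡ zeros b ++ b0 ∷ zeros d
  zeros-a = trans (cong zeros (sym (trans (+-suc b d) (m+[n∸m]≡n b<a)))) (zeros-+ b (suc d))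

  zeros-a′ : zeros a ≡ b0 ∷ zeros d ++ zeros b
  zeros-a′ = trans zeros-a (zeros-comm b (suc d))

  φ-∷ : ∀ c w → φ a b (c ∷ w) ≡ zeros (run c) ++ b1 ∷ φ a b w
  φ-∷ b0 w = ++-assoc (zeros a) (b1 ∷ []) (φ a b w)
  φ-∷ b1 w = ++-assoc (zeros b) (b1 ∷ []) (φ a b w)

  φ-++ : ∀ x y → φ a b (x ++ y) ≡ φ a b x ++ φ a b y
  φ-++ = concatMap-++ (φ₁ a b)

  φ-[] : ∀ c → φ a b (c ∷ []) ≡ zeros (run c) ++ b1 ∷ []
  φ-[] c = φ-∷ c []

  reverse-φ : ∀ w → reverse (φ a b w) ∷ʳ b1 ≡ b1 ∷ φ a b (reverse w)
  reverse-φ []      = refl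
  reverse-φ (x ∷ w) = begin
    reverse (φ a b (x ∷ w)) ∷ʳ b1
      ≡⟨ cong (λ t → reverse t ∷ʳ b1) (φ-∷ x w) ⟩
    reverse (zeros (run x) ++ b1 ∷ φ a b w) ∷ʳ b1
      ≡⟨ cong (_∷ʳ b1) (reverse-++ (zeros (run x)) (b1 ∷ φ a b w)) ⟩
    (reverse (b1 ∷ φ a b w) ++ reverse (zeros (run x))) ∷ʳ b1
      ≡⟨ cong₂ (λ s t → (s ++ t) ∷ʳ b1) (unfold-reverse b1 (φ a b w)) (reverse-zeros (run x)) ⟩
    ((reverse (φ a b w) ∷ʳ b1) ++ zeros (run x)) ∷ʳ b1
      ≡⟨ cong (λ t → (t ++ zeros (run x)) ∷ʳ b1) (reverse-φ w) ⟩
    ((b1 ∷ φ a b (reverse w)) ++ zeros (run x)) ∷ʳ b1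
      ≡⟨ cong (b1 ∷_) (++-assoc (φ a b (reverse w)) (zeros (run x)) (b1 ∷ [])) ⟩
    b1 ∷ φ a b (reverse w) ++ zeros (run x) ++ b1 ∷ []
      ≡⟨ cong (λ t → b1 ∷ φ a b (reverse w) ++ t) (sym (φ-[] x)) ⟩
    b1 ∷ φ a b (reverse w) ++ φ a b (x ∷ [])
      ≡⟨ cong (b1 ∷_) (sym (φ-++ (reverse w) (x ∷ []))) ⟩
    b1 ∷ φ a b (reverse w ∷ʳ x)
      ≡⟨ cong (λ t → b1 ∷ φ a b t) (sym (unfold-reverse x w)) ⟩
    b1 ∷ φ a b (reverse (x ∷ w)) ∎
    where open ≡-Reasoning

  grow : Word → Word
  grow h = φ a b h ++ zeros b

  T-palindrome : ∀ w h → T a b (reverse h ++ w ++ h) ≡ reverse (grow h) ++ b1 ∷ φ a b w ++ grow h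
  T-palindrome w h = begin
    zeros b ++ b1 ∷ φ a b (reverse h ++ w ++ h) ++ zeros b
      ≡⟨ cong (λ t → zeros b ++ b1 ∷ t ++ zeros b)
           (trans (φ-++ (reverse h) (w ++ h)) (cong (φ a b (reverse h) ++_) (φ-++ w h))) ⟩
    zeros b ++ b1 ∷ (φ a b (reverse h) ++ φ a b w ++ φ a b h) ++ zeros b
      ≡⟨ solve 5 (λ Z l R W H → Z ⊕ l ⊕ (R ⊕ W ⊕ H) ⊕ Z ⊜ Z ⊕ (l ⊕ R) ⊕ W ⊕ H ⊕ Z) refl
           (zeros b) (b1 ∷ []) (φ a b (reverse h)) (φ a b w) (φ a b h) ⟩
    zeros b ++ (b1 ∷ φ a b (reverse h)) ++ φ a b w ++ grow h
      ≡⟨ cong (λ t → zeros b ++ t ++ φ a b w ++ grow h) (sym (reverse-φ h)) ⟩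
    zeros b ++ (reverse (φ a b h) ∷ʳ b1) ++ φ a b w ++ grow h
      ≡⟨ solve 5 (λ Z R l W H → Z ⊕ (R ⊕ l) ⊕ W ⊕ H ⊜ (Z ⊕ R) ⊕ l ⊕ W ⊕ H) refl
           (zeros b) (reverse (φ a b h)) (b1 ∷ []) (φ a b w) (grow h) ⟩
    (zeros b ++ reverse (φ a b h)) ++ b1 ∷ φ a b w ++ grow h
      ≡⟨ cong (λ t → (t ++ reverse (φ a b h)) ++ b1 ∷ φ a b w ++ grow h) (sym (reverse-zeros b)) ⟩
    (reverse (zeros b) ++ reverse (φ a b h)) ++ b1 ∷ φ a b w ++ grow h
      ≡⟨ cong (_++ b1 ∷ φ a b w ++ grow h) (sym (reverse-++ (φ a b h) (zeros b))) ⟩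
    reverse (grow h) ++ b1 ∷ φ a b w ++ grow h ∎
    where open ≡-Reasoning

  T-palindrome-letter : ∀ x q z → zeros (run x) ≡ zeros q ++ word z ++ zeros q → ∀ h →
                        T a b (reverse h ++ (x ∷ []) ++ h) ≡ mirror z (zeros q ++ b1 ∷ grow h)
  T-palindrome-letter x q z run-split h = begin
    T a b (reverse h ++ (x ∷ []) ++ h)                 ≡⟨ T-palindrome (x ∷ []) h ⟩
    reverse (grow h) ++ b1 ∷ φ a b (x ∷ []) ++ grow h
      ≡⟨ cong (λ t → reverse (grow h) ++ b1 ∷ t ++ grow h) (trans (φ-[] x) (cong (_∷ʳ b1) run-split)) ⟩
    reverse (grow h) ++ (b1 ∷ (zeros q ++ word z ++ zeros q) ∷ʳ b1) ++ grow h ≡⟨ mirror-zeros-1 z q (grow h) ⟨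
    mirror z (zeros q ++ b1 ∷ grow h)                  ∎
    where open ≡-Reasoning

  grow-∷ : ∀ c s → ∃ λ t → grow (c ∷ s) ≡ zeros b ++ c ∷ t
  grow-∷ b0 s = zeros d ++ b1 ∷ grow s , (begin
    grow (b0 ∷ s)                               ≡⟨ cong (_++ zeros b) (φ-∷ b0 s) ⟩
    (zeros a ++ b1 ∷ φ a b s) ++ zeros b       ≡⟨ ++-assoc (zeros a) _ _ ⟩
    zeros a ++ b1 ∷ grow s                      ≡⟨ cong (_++ b1 ∷ grow s) zeros-a ⟩
    (zeros b ++ b0 ∷ zeros d) ++ b1 ∷ grow s    ≡⟨ ++-assoc (zeros b) _ _ ⟩
    zeros b ++ b0 ∷ zeros d ++ b1 ∷ grow s      ∎)
    where open ≡-Reasoning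
  grow-∷ b1 s = grow s , trans (cong (_++ zeros b) (φ-∷ b1 s)) (++-assoc (zeros b) _ _)

  grow-⊏ : ∀ {c h h′} → h ⊏[ c ] h′ → grow h ⊏[ c ] grow h′
  grow-⊏ {c} {h} (s , refl) with t , e ← grow-∷ c s = t , (begin
    φ a b (h ++ c ∷ s) ++ zeros b           ≡⟨ cong (_++ zeros b) (φ-++ h (c ∷ s)) ⟩
    (φ a b h ++ φ a b (c ∷ s)) ++ zeros b   ≡⟨ ++-assoc (φ a b h) _ _ ⟩
    φ a b h ++ grow (c ∷ s)                 ≡⟨ cong (φ a b h ++_) e ⟩
    φ a b h ++ zeros b ++ c ∷ t             ≡⟨ sym (++-assoc (φ a b h) _ _) ⟩
    grow h ++ c ∷ t                         ∎)
    where open ≡-Reasoning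

  grow-⊑ : ∀ {h h′} → h ⊑ h′ → grow h ⊑ grow h′
  grow-⊑ {h} ([]    , refl) = subst (λ t → grow h ⊑ grow t) (sym (++-identityʳ h)) (⊑-refl _)
  grow-⊑ {h} (c ∷ s , refl) = ⊏⇒⊑ (grow-⊏ {c} {h} (s , refl))

  length-φ≥ : ∀ w → length w ≤ length (φ a b w)
  length-φ≥ []      = z≤n
  length-φ≥ (c ∷ w) = begin
    suc (length w)                              ≤⟨ s≤s (length-φ≥ w) ⟩
    suc (length (φ a b w))                      ≤⟨ m≤n+m _ (length (zeros (run c))) ⟩
    length (zeros (run c)) + suc (length (φ a b w)) ≡⟨ sym (length-++ (zeros (run c))) ⟩
    length (zeros (run c) ++ b1 ∷ φ a b w)      ≡⟨ cong length (sym (φ-∷ c w)) ⟩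
    length (φ a b (c ∷ w))                      ∎
    where open ≤-Reasoning

  length-φ≤ : ∀ w → length (φ a b w) ≤ suc a * length w
  length-φ≤ []      = z≤n
  length-φ≤ (c ∷ w) = begin
    length (φ a b (c ∷ w))                      ≡⟨ cong length (φ-∷ c w) ⟩
    length (zeros (run c) ++ b1 ∷ φ a b w)      ≡⟨ length-++ (zeros (run c)) ⟩
    length (zeros (run c)) + suc (length (φ a b w)) ≡⟨ cong (_+ _) (length-replicate (run c)) ⟩
    run c + suc (length (φ a b w))              ≤⟨ +-mono-≤ (run≤a c) (s≤s (length-φ≤ w)) ⟩
    a + suc (suc a * length w)                  ≡⟨ +-suc a _ ⟩
    suc a + suc a * length w                    ≡⟨ *-suc (suc a) (length w) ⟨
    suc a * suc (length w)                      ∎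
    where open ≤-Reasoning

  φ-⊑ : ∀ {x y} → x ⊑ y → φ a b x ⊑ φ a b y
  φ-⊑ {x} (s , refl) = φ a b s , φ-++ x s

  φ-0∷ : ∀ w → ∃ λ t → φ a b (b0 ∷ w) ≡ b0 ∷ t
  φ-0∷ w = zeros d ++ zeros b ++ b1 ∷ φ a b w ,
    trans (φ-∷ b0 w) (trans (cong (_++ b1 ∷ φ a b w) zeros-a′) (cong (b0 ∷_) (++-assoc (zeros d) (zeros b) _)))

  length-φ-0∷ : ∀ w → suc (length (b0 ∷ w)) ≤ length (φ a b (b0 ∷ w))
  length-φ-0∷ w with t , e ← φ-0∷ w = begin
    suc (suc (length w))                ≤⟨ s≤s (s≤s (length-φ≥ w)) ⟩
    suc (suc (length (φ a b w)))        ≤⟨ +-monoˡ-≤ _ (subst (1 ≤_) (sym (length-replicate a)) (≤-trans (s≤s z≤n) b<a)) ⟩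
    length (zeros a) + suc (length (φ a b w)) ≡⟨ sym (length-++ (zeros a)) ⟩
    length (zeros a ++ b1 ∷ φ a b w)    ≡⟨ cong length (sym (φ-∷ b0 w)) ⟩
    length (φ a b (b0 ∷ w))             ∎
    where open ≤-Reasoning

  φⁿ₀ : ℕ → Word
  φⁿ₀ n = φ^ a b n (b0 ∷ [])

  φⁿ₀-0∷ : ∀ n → ∃ λ t → φⁿ₀ n ≡ b0 ∷ t
  φⁿ₀-0∷ zero    = [] , refl
  φⁿ₀-0∷ (suc n) with t , e ← φⁿ₀-0∷ n = subst (λ w → ∃ λ t → φ a b w ≡ b0 ∷ t) (sym e) (φ-0∷ t)

  φⁿ₀-⊑ : ∀ n → φⁿ₀ n ⊑ φⁿ₀ (suc n)
  φⁿ₀-⊑ zero    = proj₁ (φ-0∷ []) , proj₂ (φ-0∷ [])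
  φⁿ₀-⊑ (suc n) = φ-⊑ (φⁿ₀-⊑ n)

  length-φⁿ₀ : ∀ n → suc n ≤ length (φⁿ₀ n)
  length-φⁿ₀ zero    = s≤s z≤n
  length-φⁿ₀ (suc n) with t , e ← φⁿ₀-0∷ n =
    ≤-trans (s≤s (length-φⁿ₀ n)) (subst (λ w → suc (length w) ≤ length (φ a b w)) (sym e) (length-φ-0∷ t))

  open PrefixLimit φⁿ₀ φⁿ₀-⊑ (λ n → ≤-trans (n≤1+n n) (length-φⁿ₀ n)) using (nth-limit)

  Occurs : Word → Set
  Occurs w = ∃ λ N → Infix w (φⁿ₀ N)

  occurs-infix : ∀ {w x} → Infix w x → Occurs x → Occurs w
  occurs-infix w⊆x (N , x⊆φⁿ₀N) = N , infix-trans w⊆x x⊆φⁿ₀N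

  occurs⇒factor : ∀ {w} → Occurs w → Factor a b w
  occurs⇒factor {w} (N , P , Q , e) = length P , (begin
    pref (λ k → u a b (length P + k)) (length w)
      ≡⟨ pref-cong (length w) (λ k k< → nth-limit N (length P + k) (in-range k k<)) ⟩
    pref (λ k → nth (φⁿ₀ N) (length P + k)) (length w)
      ≡⟨ cong (λ t → pref (λ k → nth t (length P + k)) (length w)) e ⟩
    pref (λ k → nth (P ++ w ++ Q) (length P + k)) (length w)
      ≡⟨ pref-cong (length w) (λ k _ → nth-++ʳ P (w ++ Q) k) ⟩
    pref (nth (w ++ Q)) (length w)
      ≡⟨ pref-nth-++ w Q ⟩
    w ∎)
    where
    open ≡-Reasoning
    in-range : ∀ k → k < length w → length P + k < length (φⁿ₀ N)
    in-range k k< = subst (length P + k <_) (trans (sym (length-++ P)) (cong length (sym e)))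
                          (+-monoʳ-< (length P) (≤-trans k< (length-++-≤ˡ w)))

  factor⇒occurs : ∀ {w} → Factor a b w → Occurs w
  factor⇒occurs {w} (i , e) = N , take i L , drop (i + length w) L ,
    trans (split-at L i (length w) in-range) (cong (λ t → take i L ++ t ++ drop (i + length w) L)
      (trans (pref-cong (length w) (λ k k< → sym (nth-limit N (i + k) (≤-trans (+-monoʳ-< i k<) in-range)))) e))
    where
    N = i + length w
    L = φⁿ₀ N
    in-range : i + length w ≤ length L
    in-range = ≤-trans (n≤1+n _) (length-φⁿ₀ N)
    split-at : ∀ (L : Word) i n → i + n ≤ length L → L ≡ take i L ++ pref (λ k → nth L (i + k)) n ++ drop (i + n) L
    split-at L       zero    zero    _         = refl
    split-at (x ∷ L) zero    (suc n) (s≤s le) = cong (x ∷_) (split-at L zero n le)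
    split-at (x ∷ L) (suc i) n       (s≤s le) = cong (x ∷_) (split-at L i n le)

  occurs-in-image : ∀ {w} → Occurs w → ∃ λ N → Infix w (φ a b (φⁿ₀ N))
  occurs-in-image {w} (N , P , Q , e) with s , e′ ← φⁿ₀-⊑ N =
    N , P , Q ++ s ,
    trans e′ (trans (cong (_++ s) e) (solve 4 (λ P w Q s → (P ⊕ w ⊕ Q) ⊕ s ⊜ P ⊕ w ⊕ Q ⊕ s) refl P w Q s))

  φ-∷-ends : ∀ x w → ∃ λ A → φ a b (x ∷ w) ≡ A ++ zeros b ++ b1 ∷ []
  φ-∷-ends b0 []      = b0 ∷ zeros d ,
    trans (φ-[] b0) (trans (cong (_++ b1 ∷ []) zeros-a′) (++-assoc (b0 ∷ zeros d) (zeros b) _))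
  φ-∷-ends b1 []      = [] , φ-[] b1
  φ-∷-ends x  (y ∷ w) with A , e ← φ-∷-ends y w = zeros (run x) ++ b1 ∷ A , (begin
    φ a b (x ∷ y ∷ w)                        ≡⟨ φ-∷ x (y ∷ w) ⟩
    zeros (run x) ++ b1 ∷ φ a b (y ∷ w)      ≡⟨ cong (λ t → zeros (run x) ++ b1 ∷ t) e ⟩
    zeros (run x) ++ b1 ∷ A ++ zeros b ++ b1 ∷ [] ≡⟨ sym (++-assoc (zeros (run x)) (b1 ∷ A) _) ⟩
    (zeros (run x) ++ b1 ∷ A) ++ zeros b ++ b1 ∷ [] ∎)
    where open ≡-Reasoning

  φ-0∷-ends : ∀ w → ∃ λ A → φ a b (b0 ∷ w) ≡ b0 ∷ A ++ zeros b ++ b1 ∷ []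
  φ-0∷-ends []      = zeros d ,
    trans (φ-[] b0) (trans (cong (_++ b1 ∷ []) zeros-a′) (cong (b0 ∷_) (++-assoc (zeros d) (zeros b) _)))
  φ-0∷-ends (y ∷ w) with A , e ← φ-∷-ends y w = (zeros d ++ zeros b) ++ b1 ∷ A , (begin
    φ a b (b0 ∷ y ∷ w)                            ≡⟨ φ-∷ b0 (y ∷ w) ⟩
    zeros a ++ b1 ∷ φ a b (y ∷ w)                 ≡⟨ cong₂ (λ s t → s ++ b1 ∷ t) zeros-a′ e ⟩
    (b0 ∷ zeros d ++ zeros b) ++ b1 ∷ A ++ zeros b ++ b1 ∷ []
      ≡⟨ cong (b0 ∷_) (sym (++-assoc (zeros d ++ zeros b) (b1 ∷ A) _)) ⟩
    b0 ∷ ((zeros d ++ zeros b) ++ b1 ∷ A) ++ zeros b ++ b1 ∷ [] ∎)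
    where open ≡-Reasoning

  φ-∷-begins : ∀ c B → ∃₂ λ c′ B′ → φ a b (c ∷ B) ≡ zeros b ++ c′ ∷ B′
  φ-∷-begins b0 B = b0 , zeros d ++ b1 ∷ φ a b B ,
    trans (φ-∷ b0 B) (trans (cong (_++ b1 ∷ φ a b B) zeros-a) (++-assoc (zeros b) (b0 ∷ zeros d) _))
  φ-∷-begins b1 B = b1 , φ a b B , φ-∷ b1 B

  OccursInside : Word → Set
  OccursInside w = ∃ λ N → ∃₂ λ A c → ∃ λ B → φⁿ₀ N ≡ b0 ∷ A ++ w ++ c ∷ B

  occursInside⇒occurs : ∀ {w} → OccursInside w → Occurs w
  occursInside⇒occurs (N , A , c , B , e) = N , b0 ∷ A , c ∷ B , e

  -- φ(0 A) ends with 0^b 1 and φ(c B) begins with 0^b, so T w = 0^b 1 φ(w) 0^b lies inside φ(0 A w c B).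
  occursInside-T : ∀ {w} → OccursInside w → OccursInside (T a b w)
  occursInside-T {w} (N , A , c , B , e)
    with A′ , eA ← φ-0∷-ends A | c′ , B′ , eB ← φ-∷-begins c B = suc N , A′ , c′ , B′ , (begin
    φ a b (φⁿ₀ N)                                      ≡⟨ cong (φ a b) e ⟩
    φ a b ((b0 ∷ A) ++ w ++ c ∷ B)
      ≡⟨ trans (φ-++ (b0 ∷ A) (w ++ c ∷ B)) (cong (φ a b (b0 ∷ A) ++_) (φ-++ w (c ∷ B))) ⟩
    φ a b (b0 ∷ A) ++ φ a b w ++ φ a b (c ∷ B)         ≡⟨ cong₂ (λ s t → s ++ φ a b w ++ t) eA eB ⟩
    (b0 ∷ A′ ++ zeros b ++ b1 ∷ []) ++ φ a b w ++ zeros b ++ c′ ∷ B′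
      ≡⟨ solve 6 (λ o A Z l W C → (o ⊕ A ⊕ Z ⊕ l) ⊕ W ⊕ Z ⊕ C ⊜ o ⊕ A ⊕ (Z ⊕ l ⊕ W ⊕ Z) ⊕ C) refl
           (b0 ∷ []) A′ (zeros b) (b1 ∷ []) (φ a b w) (c′ ∷ B′) ⟩
    b0 ∷ A′ ++ T a b w ++ c′ ∷ B′                      ∎)
    where open ≡-Reasoning

  -- Desubstitution: a cut of φ(X) lies inside the image 0^(run c) 1 of a single letter.
  φ-split : ∀ X P R → φ a b X ≡ P ++ R →
    ∃₂ λ X₁ X₂ → ∃ λ j → X ≡ X₁ ++ X₂ × P ≡ φ a b X₁ ++ zeros j ×
      (  (X₂ ≡ [] × R ≡ [])
       ⊎ (∃₂ λ c X₂′ → X₂ ≡ c ∷ X₂′ × j ≤ run c × R ≡ zeros (run c ∸ j) ++ b1 ∷ φ a b X₂′))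
  φ-split []      P R e = [] , [] , 0 , refl , ++-conicalˡ P R (sym e) , inj₁ (refl , ++-conicalʳ P R (sym e))
  φ-split (c ∷ Y) P R e with zeros-1-split (run c) (φ a b Y) P R (trans (sym (φ-∷ c Y)) e)
  ... | inj₁ (j , j≤ , eP , eR) = [] , c ∷ Y , j , refl , eP , inj₂ (c , Y , refl , j≤ , eR)
  ... | inj₂ (P′ , refl , eS) with Y₁ , Y₂ , j , refl , refl , rest ← φ-split Y P′ R eS =
    c ∷ Y₁ , Y₂ , j , refl ,
    trans (solve 4 (λ Z l A B → Z ⊕ l ⊕ A ⊕ B ⊜ (Z ⊕ l ⊕ A) ⊕ B) refl (zeros (run c)) (b1 ∷ []) (φ a b Y₁) (zeros j))
          (cong (_++ zeros j) (sym (φ-∷ c Y₁))) ,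
    rest

  φ-split-after-1 : ∀ X P R → φ a b X ≡ P ++ b1 ∷ R →
    ∃₂ λ X₁ X₂ → X ≡ X₁ ++ X₂ × φ a b X₁ ≡ P ∷ʳ b1 × φ a b X₂ ≡ R
  φ-split-after-1 X P R e with φ-split X P (b1 ∷ R) e
  ... | X₁ , X₂ , j , eX , eP , inj₁ (_ , ())
  ... | X₁ , X₂ , j , eX , eP , inj₂ (c , X₂′ , refl , j≤ , eR) with run c ∸ j in eq
  ...   | suc _ with () ← proj₁ (∷-injective eR)
  ...   | zero  = X₁ ∷ʳ c , X₂′ , trans eX (sym (++-assoc X₁ (c ∷ []) X₂′)) , (begin
    φ a b (X₁ ∷ʳ c)                     ≡⟨ trans (φ-++ X₁ (c ∷ [])) (cong (φ a b X₁ ++_) (φ-[] c)) ⟩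
    φ a b X₁ ++ zeros (run c) ++ b1 ∷ [] ≡⟨ cong (λ n → φ a b X₁ ++ zeros n ++ b1 ∷ []) run≡j ⟩
    φ a b X₁ ++ zeros j ++ b1 ∷ []      ≡⟨ sym (++-assoc (φ a b X₁) (zeros j) _) ⟩
    (φ a b X₁ ++ zeros j) ∷ʳ b1         ≡⟨ cong (_∷ʳ b1) (sym eP) ⟩
    P ∷ʳ b1                             ∎) , sym (proj₂ (∷-injective eR))
    where
    open ≡-Reasoning
    run≡j : run c ≡ j
    run≡j = ≤-antisym (m∸n≡0⇒m≤n eq) j≤

  φ-zero-run : ∀ X P k Q → φ a b X ≡ P ++ zeros k ++ Q → k ≤ a
  φ-zero-run X P k Q e with φ-split X P (zeros k ++ Q) e
  ... | _ , _ , j , _ , _ , inj₂ (c , _ , _ , _ , eR) =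
    ≤-trans (zeros-prefix-≤ k _ Q _ eR) (≤-trans (m∸n≤m (run c) j) (run≤a c))
  ... | _ , _ , _ , _ , _ , inj₁ (_ , eR) with k
  ...   | zero = z≤n

  φ-gap : ∀ X P k Q → φ a b X ≡ P ++ b1 ∷ zeros k ++ b1 ∷ Q → ∃ λ c → run c ≡ k
  φ-gap X P k Q e with φ-split-after-1 X P (zeros k ++ b1 ∷ Q) e
  ... | _ , []     , _ , _ , e₂ = ⊥-elim (zeros-1-nonempty k Q (sym e₂))
  ... | _ , c ∷ X₂ , _ , _ , e₂ = c , proj₁ (zeros-1-injective (run c) k _ Q (trans (sym (φ-∷ c X₂)) e₂))

  φ-cancelˡ : ∀ t X Q → φ a b X ≡ φ a b t ++ Q → ∃ λ X′ → X ≡ t ++ X′ × φ a b X′ ≡ Q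
  φ-cancelˡ []      X       Q e = X , refl , e
  φ-cancelˡ (c ∷ t) []      Q e = ⊥-elim (zeros-1-nonempty (run c) (φ a b t ++ Q)
    (sym (trans e (trans (cong (_++ Q) (φ-∷ c t)) (++-assoc (zeros (run c)) _ Q)))))
  φ-cancelˡ (c ∷ t) (x ∷ Y) Q e
    with run≡ , eY ← zeros-1-injective (run x) (run c) (φ a b Y) (φ a b t ++ Q)
           (trans (sym (φ-∷ x Y)) (trans e (trans (cong (_++ Q) (φ-∷ c t)) (++-assoc (zeros (run c)) _ Q))))
    with refl ← run-injective run≡
    with X′ , refl , e′ ← φ-cancelˡ t Y Q eY = X′ , refl , e′

  φ-long-zeros-head : ∀ X k R → b < k → φ a b X ≡ zeros k ++ R → ∃ λ X′ → X ≡ b0 ∷ X′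
  φ-long-zeros-head []        (suc k) R _   ()
  φ-long-zeros-head (b0 ∷ X′) k       R _   _ = X′ , refl
  φ-long-zeros-head (b1 ∷ X′) k       R b<k e = ⊥-elim (<⇒≱ b<k (zeros-prefix-≤ k b R _ (trans (sym e) (φ-∷ b1 X′))))

  φ-long-zeros-last : ∀ X P k → b < k → φ a b X ≡ P ++ zeros k ++ b1 ∷ [] → ∃ λ X′ → X ≡ X′ ∷ʳ b0
  φ-long-zeros-last X P k b<k e = reverse-head (φ-long-zeros-head (reverse X) k (reverse P ∷ʳ b1) b<k reversed)
    where
    open ≡-Reasoning
    reverse-head : (∃ λ X′ → reverse X ≡ b0 ∷ X′) → ∃ λ X′ → X ≡ X′ ∷ʳ b0
    reverse-head (X′ , eX) = reverse X′ , trans (sym (reverse-involutive X)) (trans (cong reverse eX) (unfold-reverse b0 X′))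
    reversed : φ a b (reverse X) ≡ zeros k ++ reverse P ∷ʳ b1
    reversed = proj₂ (∷-injective (begin
      b1 ∷ φ a b (reverse X)                    ≡⟨ sym (reverse-φ X) ⟩
      reverse (φ a b X) ∷ʳ b1                   ≡⟨ cong (λ t → reverse t ∷ʳ b1) e ⟩
      reverse (P ++ zeros k ++ b1 ∷ []) ∷ʳ b1
        ≡⟨ cong (_∷ʳ b1) (trans (reverse-++ P (zeros k ++ b1 ∷ [])) (cong (_++ reverse P)
             (trans (reverse-++ (zeros k) (b1 ∷ [])) (cong (b1 ∷_) (reverse-zeros k))))) ⟩
      ((b1 ∷ zeros k) ++ reverse P) ∷ʳ b1      ≡⟨ cong (b1 ∷_) (++-assoc (zeros k) (reverse P) _) ⟩
      b1 ∷ zeros k ++ reverse P ∷ʳ b1           ∎))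

  occurs-zeros : ∀ k → Occurs (zeros k) → k ≤ a
  occurs-zeros k occ with N , P , Q , e ← occurs-in-image occ = φ-zero-run (φⁿ₀ N) P k Q e

  occurs-gap : ∀ k → Occurs (b1 ∷ zeros k ∷ʳ b1) → ∃ λ c → run c ≡ k
  occurs-gap k occ with N , P , Q , e ← occurs-in-image occ = φ-gap (φⁿ₀ N) P k Q
    (trans e (solve 4 (λ P Z l Q → P ⊕ (Z ⊕ l) ⊕ Q ⊜ P ⊕ Z ⊕ l ⊕ Q) refl P (b1 ∷ zeros k) (b1 ∷ []) Q))

  occurs-between-1s : ∀ Y → Occurs (b1 ∷ Y ∷ʳ b1) → ∃ λ g → Y ∷ʳ b1 ≡ φ a b g
  occurs-between-1s Y occ with N , P , Q , e ← occurs-in-image occ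
    with _ , X₂ , _ , _ , e₂ ← φ-split-after-1 (φⁿ₀ N) P (Y ++ b1 ∷ Q)
           (trans e (solve 4 (λ P Y l Q → P ⊕ (Y ⊕ l) ⊕ Q ⊜ P ⊕ Y ⊕ l ⊕ Q) refl P (b1 ∷ Y) (b1 ∷ []) Q))
    with g , _ , _ , eg , _ ← φ-split-after-1 X₂ Y Q e₂ = g , sym eg

  occurs-after-1 : ∀ P h → Occurs (P ++ b1 ∷ h) → ∃₂ λ g i → h ≡ φ a b g ++ zeros i
  occurs-after-1 P h occ with split-trailing-zeros h
  ... | Y , i , eh , inj₁ refl        = [] , i , eh
  ... | Y , i , eh , inj₂ (Y′ , refl)
    with g , eg ← occurs-between-1s Y′ (occurs-infix (P , zeros i , refl) (subst (λ t → Occurs (P ++ b1 ∷ t)) eh occ))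
    = g , i , trans eh (cong (_++ zeros i) eg)

  framed : ℕ → Word → Word
  framed i w = zeros i ++ b1 ∷ φ a b w ++ zeros i

  occurs-framed : ∀ i t → Occurs (framed i t) → Occurs t × (b < i → Occurs (b0 ∷ t ∷ʳ b0))
  occurs-framed i t occ with N , P , Q , e ← occurs-in-image occ
    with X₁ , X₂ , eX , e₁ , e₂ ← φ-split-after-1 (φⁿ₀ N) (P ++ zeros i) (φ a b t ++ zeros i ++ Q)
           (trans e (solve 5 (λ P Z l W Q → P ⊕ (Z ⊕ l ⊕ W ⊕ Z) ⊕ Q ⊜ (P ⊕ Z) ⊕ l ⊕ W ⊕ Z ⊕ Q) refl
                       P (zeros i) (b1 ∷ []) (φ a b t) Q))
    with X₃ , refl , e₃ ← φ-cancelˡ t X₂ (zeros i ++ Q) e₂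
    = (N , X₁ , X₃ , eX) , bordered
    where
    bordered : b < i → Occurs (b0 ∷ t ∷ʳ b0)
    bordered b<i with X₁′ , refl ← φ-long-zeros-last X₁ P i b<i (trans e₁ (++-assoc P (zeros i) _))
                 with X₃′ , refl ← φ-long-zeros-head X₃ i Q b<i e₃ = N , X₁′ , X₃′ ,
      trans eX (solve 4 (λ A o t B → (A ⊕ o) ⊕ t ⊕ o ⊕ B ⊜ A ⊕ (o ⊕ t ⊕ o) ⊕ B) refl X₁′ (b0 ∷ []) t X₃′)

  mirror-framed : ∀ z j g i m → φ a b m ≡ zeros j ++ word z ++ zeros j ∷ʳ b1 →
    mirror z (zeros j ++ b1 ∷ φ a b g ++ zeros i) ≡ framed i (reverse g ++ m ++ g)
  mirror-framed z j g i m em = begin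
    mirror z (zeros j ++ b1 ∷ φ a b g ++ zeros i)
      ≡⟨ mirror-zeros-1 z j (φ a b g ++ zeros i) ⟩
    reverse (φ a b g ++ zeros i) ++ (b1 ∷ (zeros j ++ word z ++ zeros j) ∷ʳ b1) ++ φ a b g ++ zeros i
      ≡⟨ cong (_++ (b1 ∷ (zeros j ++ word z ++ zeros j) ∷ʳ b1) ++ φ a b g ++ zeros i)
           (trans (reverse-++ (φ a b g) (zeros i)) (cong (_++ reverse (φ a b g)) (reverse-zeros i))) ⟩
    (zeros i ++ reverse (φ a b g)) ++ (b1 ∷ (zeros j ++ word z ++ zeros j) ∷ʳ b1) ++ φ a b g ++ zeros i
      ≡⟨ solve 7 (λ Z R l J W G x → (Z ⊕ R) ⊕ (l ⊕ J ⊕ l) ⊕ G ⊕ Z ⊜ Z ⊕ (R ⊕ l) ⊕ (J ⊕ l) ⊕ G ⊕ Z) refl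
           (zeros i) (reverse (φ a b g)) (b1 ∷ []) (zeros j ++ word z ++ zeros j) [] (φ a b g) [] ⟩
    zeros i ++ (reverse (φ a b g) ∷ʳ b1) ++ ((zeros j ++ word z ++ zeros j) ∷ʳ b1) ++ φ a b g ++ zeros i
      ≡⟨ cong₂ (λ s t → zeros i ++ s ++ t ++ φ a b g ++ zeros i) (reverse-φ g)
           (trans (++-assoc (zeros j) _ _) (trans (cong (zeros j ++_) (++-assoc (word z) _ _)) (sym em))) ⟩
    zeros i ++ (b1 ∷ φ a b (reverse g)) ++ φ a b m ++ φ a b g ++ zeros i
      ≡⟨ cong (λ t → zeros i ++ b1 ∷ t)
           (solve 4 (λ A B C D → A ⊕ B ⊕ C ⊕ D ⊜ (A ⊕ B ⊕ C) ⊕ D) refl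
              (φ a b (reverse g)) (φ a b m) (φ a b g) (zeros i)) ⟩
    zeros i ++ b1 ∷ (φ a b (reverse g) ++ φ a b m ++ φ a b g) ++ zeros i
      ≡⟨ cong (λ t → zeros i ++ b1 ∷ t ++ zeros i)
           (sym (trans (φ-++ (reverse g) (m ++ g)) (cong (φ a b (reverse g) ++_) (φ-++ m g)))) ⟩
    framed i (reverse g ++ m ++ g) ∎
    where open ≡-Reasoning

  φ-[0] : φ a b (b0 ∷ []) ≡ b0 ∷ zeros d ++ zeros b ++ b1 ∷ []
  φ-[0] = proj₂ (φ-0∷-ends [])

  occursInside-V : ∀ m → OccursInside (V a b (suc m))
  occursInside-V zero    = 1 , zeros d , b1 , [] , φ-[0]
  occursInside-V (suc m) = occursInside-T (occursInside-V m)

  occursInside-W : 1 ≤ b → ∀ m → OccursInside (W a b (suc m))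
  occursInside-W 1≤b zero with c , B , e ← ∷ʳ-nonempty (zeros d) b1 = 1 , zeros (b ∸ 1) , c , B , (begin
    φ a b (b0 ∷ [])                            ≡⟨ φ-[] b0 ⟩
    zeros a ++ b1 ∷ []                         ≡⟨ cong (_++ b1 ∷ []) zeros-a ⟩
    (zeros b ++ b0 ∷ zeros d) ++ b1 ∷ []
      ≡⟨ cong (λ n → (zeros n ++ b0 ∷ zeros d) ++ b1 ∷ []) (sym (m+[n∸m]≡n 1≤b)) ⟩
    (b0 ∷ zeros (b ∸ 1) ++ b0 ∷ zeros d) ++ b1 ∷ []
      ≡⟨ cong (b0 ∷_) (++-assoc (zeros (b ∸ 1)) (b0 ∷ zeros d) (b1 ∷ [])) ⟩
    b0 ∷ zeros (b ∸ 1) ++ b0 ∷ zeros d ++ b1 ∷ [] ≡⟨ cong (λ t → b0 ∷ zeros (b ∸ 1) ++ b0 ∷ t) e ⟩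
    b0 ∷ zeros (b ∸ 1) ++ b0 ∷ c ∷ B           ∎)
    where open ≡-Reasoning
  occursInside-W 1≤b (suc m) = occursInside-T (occursInside-W 1≤b m)

  occurs-mirror-gap : ∀ z j h → Occurs (mirror z (zeros j ++ b1 ∷ h)) → Occurs (b1 ∷ (zeros j ++ word z ++ zeros j) ∷ʳ b1)
  occurs-mirror-gap z j h = occurs-infix (reverse h , h , mirror-zeros-1 z j h)

  occurs-odd-gap : ∀ j h′ → Occurs (mirror c0 (zeros j ++ b1 ∷ h′)) → Occurs (b1 ∷ zeros (j + suc j) ∷ʳ b1)
  occurs-odd-gap j h′ occ = subst (λ t → Occurs (b1 ∷ t ∷ʳ b1)) (sym (zeros-+ j (suc j))) (occurs-mirror-gap c0 j h′ occ)

  occurs-even-gap : ∀ j h′ → Occurs (mirror cε (zeros j ++ b1 ∷ h′)) → Occurs (b1 ∷ zeros (j + j) ∷ʳ b1)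
  occurs-even-gap j h′ occ = subst (λ t → Occurs (b1 ∷ t ∷ʳ b1)) (sym (zeros-+ j j)) (occurs-mirror-gap cε j h′ occ)

  length-framed-half : ∀ j g i → length (zeros j ++ b1 ∷ φ a b g ++ zeros i) ≡ j + suc (length (φ a b g) + i)
  length-framed-half j g i = begin
    length (zeros j ++ b1 ∷ φ a b g ++ zeros i)          ≡⟨ length-++ (zeros j) ⟩
    length (zeros j) + suc (length (φ a b g ++ zeros i))
      ≡⟨ cong₂ (λ m n → m + suc n) (length-replicate j) (length-++ (φ a b g)) ⟩
    j + suc (length (φ a b g) + length (zeros i))        ≡⟨ cong (λ n → j + suc (length (φ a b g) + n)) (length-replicate i) ⟩
    j + suc (length (φ a b g) + i)                       ∎
    where open ≡-Reasoning

  occurs-one-gap : ∀ j h′ → Occurs (mirror c1 (zeros j ++ b1 ∷ h′)) → Occurs (b1 ∷ zeros j ∷ʳ b1)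
  occurs-one-gap j h′ = occurs-infix ([] , zeros j ∷ʳ b1 , cong (b1 ∷_) assoc) ∘ occurs-mirror-gap c1 j h′
    where
    assoc : (zeros j ++ b1 ∷ zeros j) ∷ʳ b1 ≡ (zeros j ∷ʳ b1) ++ zeros j ∷ʳ b1
    assoc = solve 2 (λ J l → (J ⊕ l ⊕ J) ⊕ l ⊜ (J ⊕ l) ⊕ J ⊕ l) refl (zeros j) (b1 ∷ [])

  occurs-framed-zeros : ∀ j g i → Occurs (zeros j ++ b1 ∷ φ a b g ++ zeros i) → i ≤ a
  occurs-framed-zeros j g i = occurs-zeros i ∘ occurs-infix (zeros j ++ b1 ∷ φ a b g , [] ,
    trans (sym (++-assoc (zeros j) (b1 ∷ φ a b g) (zeros i))) (cong ((zeros j ++ b1 ∷ φ a b g) ++_) (sym (++-identityʳ (zeros i)))))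

  bounded-halves⇒¬branch : ∀ z B → (∀ h → Occurs (mirror z h) → length h ≤ B) → ¬ ∃ λ v → IsBranch a b (word z) v
  bounded-halves⇒¬branch z B short (v , branch) =
    1+n≰n (subst (_≤ B) (length-applyUpTo v (suc B)) (short (pref v (suc B)) (factor⇒occurs (branch (suc B)))))

  module EvenRuns (qa qb : ℕ) (a-even : a ≡ qa + qa) (b-even : b ≡ qb + qb) where

    no-odd-run : ∀ j → ¬ ∃ λ c → run c ≡ j + suc j
    no-odd-run j (b0 , a≡) = double≢double+1 qa j (trans (sym a-even) a≡)
    no-odd-run j (b1 , b≡) = double≢double+1 qb j (trans (sym b-even) b≡)

    -- A 0-centered palindrome containing a 1 would contain a run 1 0^(2j+1) 1 of odd length.
    occurs-mirror-0 : ∀ h → Occurs (mirror c0 h) → length h ≤ a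
    occurs-mirror-0 h occ with split-leading-zeros h
    ... | inj₁ eh = ≤-trans (m≤m+n L (suc L))
                      (occurs-zeros (L + suc L) (subst Occurs (trans (cong (mirror c0) eh) (mirror-zeros-0 L)) occ))
      where L = length h
    ... | inj₂ (j , h′ , refl) = ⊥-elim (no-odd-run j (occurs-gap (j + suc j) (occurs-odd-gap j h′ occ)))

  module OddRuns (qa qb : ℕ) (a-odd : a ≡ qa + suc qa) (b-odd : b ≡ qb + suc qb) where

    no-even-run : ∀ j → ¬ ∃ λ c → run c ≡ j + j
    no-even-run j (b0 , a≡) = double≢double+1 j qa (trans (sym a≡) a-odd)
    no-even-run j (b1 , b≡) = double≢double+1 j qb (trans (sym b≡) b-odd)

    -- An ε-centered palindrome containing a 1 would contain a run 1 0^(2j) 1 of even length.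
    occurs-mirror-ε : ∀ h → Occurs (mirror cε h) → length h ≤ a
    occurs-mirror-ε h occ with split-leading-zeros h
    ... | inj₁ eh = ≤-trans (m≤m+n L L)
                      (occurs-zeros (L + L) (subst Occurs (trans (cong (mirror cε) eh) (mirror-zeros-ε L)) occ))
      where L = length h
    ... | inj₂ (j , h′ , refl) = ⊥-elim (no-even-run j (occurs-gap (j + j) (occurs-even-gap j h′ occ)))

    occurs-mirror-1-zeros : ∀ L → Occurs (mirror c1 (zeros L)) → L ≤ a
    occurs-mirror-1-zeros L occ = occurs-zeros L (occurs-infix ([] , b1 ∷ zeros L , cong (_++ b1 ∷ zeros L) (reverse-zeros L)) occ)

    -- With j = run c, the 1-centered palindrome 0^i 1 φ(ḡ) 0^j 1 0^j 1 φ(g) 0^i = 0^i 1 φ(ḡ c c g) 0^i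
    -- desubstitutes to ḡ c c g.
    occurs-mirror-1-framed : ∀ c g i → Occurs (mirror c1 (zeros (run c) ++ b1 ∷ φ a b g ++ zeros i)) → length g ≤ a
    occurs-mirror-1-framed c g i occ = ≤-trans (n≤1+n _) (occurs-mirror-ε (c ∷ g) (subst Occurs (sym (mirror-ε-∷ c g))
      (proj₁ (occurs-framed i (reverse g ++ (c ∷ c ∷ []) ++ g)
        (subst Occurs (mirror-framed c1 (run c) g i (c ∷ c ∷ []) φcc) occ)))))
      where
      φcc : φ a b (c ∷ c ∷ []) ≡ zeros (run c) ++ word c1 ++ zeros (run c) ∷ʳ b1
      φcc = trans (φ-∷ c (c ∷ [])) (cong (λ t → zeros (run c) ++ b1 ∷ t) (φ-[] c))

    occurs-mirror-1 : ∀ h → Occurs (mirror c1 h) → length h ≤ a + suc (suc a * a + a)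
    occurs-mirror-1 h occ with split-leading-zeros h
    ... | inj₁ eh = ≤-trans (occurs-mirror-1-zeros (length h) (subst (λ t → Occurs (mirror c1 t)) eh occ)) (m≤m+n a _)
    ... | inj₂ (j , h′ , refl) = bound (occurs-gap j (occurs-one-gap j h′ occ))
                                       (occurs-after-1 (zeros j) h′ (occurs-infix (half-infix c1 (zeros j ++ b1 ∷ h′)) occ))
      where
      bound : (∃ λ c → run c ≡ j) → (∃₂ λ g i → h′ ≡ φ a b g ++ zeros i) →
              length (zeros j ++ b1 ∷ h′) ≤ a + suc (suc a * a + a)
      bound (c , refl) (g , i , refl) = begin
        length (zeros (run c) ++ b1 ∷ φ a b g ++ zeros i) ≡⟨ length-framed-half (run c) g i ⟩
        run c + suc (length (φ a b g) + i)
          ≤⟨ +-mono-≤ (run≤a c) (s≤s (+-mono-≤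
               (≤-trans (length-φ≤ g) (*-monoʳ-≤ (suc a) (occurs-mirror-1-framed c g i occ)))
               (occurs-framed-zeros (run c) g i (occurs-infix (half-infix c1 _) occ)))) ⟩
        a + suc (suc a * a + a)                           ∎
        where open ≤-Reasoning

-- Iterating T on palindromes

module Iteration (a b : ℕ) (b<a : b < a) (1≤b : 1 ≤ b) (qa qb : ℕ) (za zb : Center)
                 (a-split : zeros a ≡ zeros qa ++ word za ++ zeros qa)
                 (b-split : zeros b ≡ zeros qb ++ word zb ++ zeros qb) where
  open Substitution a b b<a public

  next : Center → Center
  next cε = c1
  next c0 = za
  next c1 = zb

  -- φ(x) = 0^q z 0^q 1 for (x , q , z) = (0 , qa , za) and (1 , qb , zb), so T maps the palindrome
  -- with center z and half h to step (z ⊲ h).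
  step : Mirror → Mirror
  step (cε ⊲ h) = c1 ⊲ grow h
  step (c0 ⊲ h) = za ⊲ zeros qa ++ b1 ∷ grow h
  step (c1 ⊲ h) = zb ⊲ zeros qb ++ b1 ∷ grow h

  T-step : ∀ p → T a b ⟦ p ⟧ ≡ ⟦ step p ⟧
  T-step (cε ⊲ h) = T-palindrome [] h
  T-step (c0 ⊲ h) = T-palindrome-letter b0 qa za a-split h
  T-step (c1 ⊲ h) = T-palindrome-letter b1 qb zb b-split h

  iter : ℕ → Mirror → Mirror
  iter n p = fold p step n

  iter-+ : ∀ m n p → iter (m + n) p ≡ iter m (iter n p)
  iter-+ m n p = fold-+ p step m

  iter-comm : ∀ m n p → iter m (iter n p) ≡ iter n (iter m p)
  iter-comm m n p = trans (sym (iter-+ m n p)) (trans (cong (λ k → iter k p) (+-comm m n)) (iter-+ n m p))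

  mid-iter : ∀ n p → mid (iter n p) ≡ fold (mid p) next n
  mid-iter zero    p = refl
  mid-iter (suc n) p = trans (mid-step (iter n p)) (cong next (mid-iter n p))
    where
    mid-step : ∀ p → mid (step p) ≡ next (mid p)
    mid-step (cε ⊲ h) = refl
    mid-step (c0 ⊲ h) = refl
    mid-step (c1 ⊲ h) = refl

  T-iter : (S : ℕ → Word) → (∀ m → S (suc (suc m)) ≡ T a b (S (suc m))) →
           ∀ {p} → S 1 ≡ ⟦ p ⟧ → ∀ m → S (suc m) ≡ ⟦ iter m p ⟧
  T-iter S rec S₁ zero    = S₁
  T-iter S rec {p} S₁ (suc m) = trans (rec m) (trans (cong (T a b) (T-iter S rec S₁ m)) (T-step (iter m p)))

  center-iter : ∀ {S : ℕ → Word} {p} → (∀ m → S (suc m) ≡ ⟦ iter m p ⟧) →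
                ∀ m → center (S (suc m)) ≡ word (fold (mid p) next m)
  center-iter {S} {p} S-iter m =
    trans (cong center (S-iter m)) (trans (center-mirror (mid (iter m p)) (half (iter m p))) (cong word (mid-iter m p)))

  infix 4 _≺[_]_

  _≺[_]_ : Mirror → Bit → Mirror → Set
  p ≺[ c ] p′ = mid p ≡ mid p′ × half p ⊏[ c ] half p′

  step-≺ : ∀ {c p p′} → p ≺[ c ] p′ → step p ≺[ c ] step p′
  step-≺ {p = cε ⊲ h} (refl , ext) = refl , grow-⊏ ext
  step-≺ {p = c0 ⊲ h} (refl , ext) = refl , ⊏-++ˡ (zeros qa) (⊏-++ˡ (b1 ∷ []) (grow-⊏ ext))
  step-≺ {p = c1 ⊲ h} (refl , ext) = refl , ⊏-++ˡ (zeros qb) (⊏-++ˡ (b1 ∷ []) (grow-⊏ ext))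

  iter-≺ : ∀ n {c p p′} → p ≺[ c ] p′ → iter n p ≺[ c ] iter n p′
  iter-≺ zero    rel = rel
  iter-≺ (suc n) rel = step-≺ (iter-≺ n rel)

  length-grow : ∀ h → length h < length (grow h)
  length-grow h = begin-strict
    length h                          <⟨ m<m+n (length h) 1≤b ⟩
    length h + b                      ≤⟨ +-mono-≤ (length-φ≥ h) (≤-reflexive (sym (length-replicate b))) ⟩
    length (φ a b h) + length (zeros b) ≡⟨ length-++ (φ a b h) ⟨
    length (grow h)                   ∎
    where open ≤-Reasoning

  length-step : ∀ p → length (half p) < length (half (step p))
  length-step (cε ⊲ h) = length-grow h
  length-step (c0 ⊲ h) = ≤-trans (≤-trans (length-grow h) (n≤1+n _)) (length-++-≤ʳ (b1 ∷ grow h) {zeros qa})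
  length-step (c1 ⊲ h) = ≤-trans (≤-trans (length-grow h) (n≤1+n _)) (length-++-≤ʳ (b1 ∷ grow h) {zeros qb})

  length-iter : ∀ n p → n + length (half p) ≤ length (half (iter n p))
  length-iter zero    p = ≤-refl
  length-iter (suc n) p = ≤-trans (s≤s (length-iter n p)) (length-step (iter n p))

  -- If P steps extend the half of p by the letter c′, each residue class mod P of the orbit of p is a chain of
  -- nested palindromes, whose limit is a branch.
  module Branches (S : ℕ → Word) (p : Mirror) (S-iter : ∀ m → S (suc m) ≡ ⟦ iter m p ⟧)
                  (occurs : ∀ m → Occurs (S (suc m)))
                  (P : ℕ) .{{_ : NonZero P}} (c′ : Bit) (period : p ≺[ c′ ] iter P p) where

    orbit : ℕ → ℕ → Mirror
    orbit r k = iter (k * P) (iter r p)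

    orbit-≺ : ∀ r k → orbit r k ≺[ c′ ] orbit r (suc k)
    orbit-≺ r k =
      subst (orbit r k ≺[ c′ ]_) shift (iter-≺ (k * P) (subst (iter r p ≺[ c′ ]_) (iter-comm r P p) (iter-≺ r period)))
      where
      shift : iter (k * P) (iter P (iter r p)) ≡ orbit r (suc k)
      shift = trans (iter-comm (k * P) P (iter r p)) (sym (iter-+ P (k * P) (iter r p)))

    mid-orbit : ∀ r k → mid (orbit r k) ≡ mid (iter r p)
    mid-orbit r zero    = refl
    mid-orbit r (suc k) = trans (sym (proj₁ (orbit-≺ r k))) (mid-orbit r k)

    orbit-long : ∀ r k → k ≤ length (half (orbit r k))
    orbit-long r k = ≤-trans (≤-trans (m≤m*n k P) (m≤m+n (k * P) _)) (length-iter (k * P) (iter r p))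

    halves : ℕ → ℕ → Word
    halves r k = half (orbit r k)

    module Limit (r : ℕ) = PrefixLimit (halves r) (λ k → ⊏⇒⊑ (proj₂ (orbit-≺ r k))) (orbit-long r)

    branch : ℕ → ℕ → Bit
    branch r = Limit.limit r

    S-orbit : ∀ r k → S (P * k + suc r) ≡ mirror (mid (iter r p)) (halves r k)
    S-orbit r k = begin
      S (P * k + suc r)        ≡⟨ cong S (+-suc (P * k) r) ⟩
      S (suc (P * k + r))      ≡⟨ S-iter (P * k + r) ⟩
      ⟦ iter (P * k + r) p ⟧   ≡⟨ cong (λ n → ⟦ iter (n + r) p ⟧) (*-comm P k) ⟩
      ⟦ iter (k * P + r) p ⟧   ≡⟨ cong ⟦_⟧ (iter-+ (k * P) r p) ⟩
      ⟦ orbit r k ⟧            ≡⟨ cong (λ z → mirror z (halves r k)) (mid-orbit r k) ⟩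
      mirror (mid (iter r p)) (halves r k) ∎
      where open ≡-Reasoning

    branch-isBranch : ∀ r → IsBranch a b (word (mid (iter r p))) (branch r)
    branch-isBranch r n = occurs⇒factor (occurs-infix
      (centralFactor⇒infix (⊑⇒centralFactor (mid (iter r p)) (Limit.pref-limit-⊑ r n (orbit-long r n))))
      (subst Occurs (trans (cong S (sym (+-suc (P * n) r))) (S-orbit r n)) (occurs (P * n + r))))

    branch-limit : ∀ r → IsBidiLimit (λ k → S (P * k + suc r)) (word (mid (iter r p))) (branch r)
    branch-limit r = (λ k → length (halves r k) , trans (S-orbit r k) (cong (mirror _) (sym (Limit.pref-limit r k))))
                   , (λ m → m , ≤-trans (orbit-long r m)
                       (subst (λ w → length (halves r m) ≤ length w) (sym (S-orbit r m)) (length-half≤mirror _ (halves r m))))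

    branch-next : ∀ r k → pref (branch r) (suc (length (halves r k))) ≡ halves r k ∷ʳ c′
    branch-next r k = ⊑∧⊏⇒≡∷ʳ (Limit.pref-limit-⊑ r (suc k) (⊏⇒length< ext)) ext (length-applyUpTo (branch r) _)
      where ext = proj₂ (orbit-≺ r k)

    iter-as-orbit : ∀ m → iter m p ≡ orbit (m % P) (m / P)
    iter-as-orbit m = trans (cong (λ n → iter n p) (trans (m≡m%n+[m/n]*n m P) (+-comm (m % P) _))) (iter-+ (m / P * P) (m % P) p)

    mid-residue : ∀ m → mid (iter m p) ≡ mid (iter (m % P) p)
    mid-residue m = trans (cong mid (iter-as-orbit m)) (mid-orbit (m % P) (m / P))

    module Compare {S′ : ℕ → Word} {pU c} (S′-iter : ∀ m → S′ (suc m) ≡ ⟦ iter m pU ⟧)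
                   (c≢c′ : c ≢ c′) (p≺pU : p ≺[ c ] pU) where

      branch-lcc : ∀ m → LongestCommonCentral (S′ (suc m)) (word (mid (iter m p))) (branch (m % P)) (S (suc m))
      branch-lcc m with mid≡ , ext ← iter-≺ m p≺pU =
        subst₂ (λ X Y → LongestCommonCentral X (word (mid (iter m p))) (branch (m % P)) Y)
          (trans (cong (λ z → mirror z (half (iter m pU))) mid≡) (sym (S′-iter m))) (sym (S-iter m))
          (longestCommonCentral-mirror (mid (iter m p)) (branch (m % P)) c≢c′ ext continues)
        where
        continues : pref (branch (m % P)) (suc (length (half (iter m p)))) ≡ half (iter m p) ∷ʳ c′
        continues = subst (λ q → pref (branch (m % P)) (suc (length (half q))) ≡ half q ∷ʳ c′) (sym (iter-as-orbit m))
                      (branch-next (m % P) (m / P))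

      -- When the P centers along a period are distinct, the center of a palindrome determines its residue class.
      branch-lcc-at : (∀ {i j} → i < P → j < P → mid (iter i p) ≡ mid (iter j p) → i ≡ j) →
        ∀ r → r < P → ∀ m → center (S′ (suc m)) ≡ word (mid (iter r p)) →
        LongestCommonCentral (S′ (suc m)) (word (mid (iter r p))) (branch r) (S (suc m))
      branch-lcc-at distinct r r<P m center≡ =
        subst (λ r → LongestCommonCentral (S′ (suc m)) (word (mid (iter r p))) (branch r) (S (suc m))) residue≡
          (subst (λ z → LongestCommonCentral (S′ (suc m)) (word z) (branch (m % P)) (S (suc m))) (mid-residue m) (branch-lcc m))
        where
        open ≡-Reasoning
        residue≡ : m % P ≡ r
        residue≡ = distinct (m%n<n m P) r<P (word-injective (begin
          word (mid (iter (m % P) p)) ≡⟨ cong word (mid-residue m) ⟨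
          word (mid (iter m p))       ≡⟨ cong word (proj₁ (iter-≺ m p≺pU)) ⟩
          word (mid (iter m pU))      ≡⟨ center-mirror (mid (iter m pU)) (half (iter m pU)) ⟨
          center ⟦ iter m pU ⟧        ≡⟨ cong center (S′-iter m) ⟨
          center (S′ (suc m))         ≡⟨ center≡ ⟩
          word (mid (iter r p))       ∎))

-- When b is even, the orbit of V^(1) = 0^b alternates between the centers ε and 1.

module EvenB (a b : ℕ) (b<a : b < a) (1≤b : 1 ≤ b) (qa qb : ℕ) (za : Center)
             (a-split : zeros a ≡ zeros qa ++ word za ++ zeros qa) (b≡ : b ≡ qb + qb) where
  open Iteration a b b<a 1≤b qa qb za cε a-split (trans (cong zeros b≡) (zeros-+ qb qb)) public

  V₁ : Mirror
  V₁ = cε ⊲ zeros qb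

  V-iter : ∀ m → V a b (suc m) ≡ ⟦ iter m V₁ ⟧
  V-iter = T-iter (V a b) (λ _ → refl) (trans (cong zeros b≡) (sym (mirror-zeros-ε qb)))

  open Branches (V a b) V₁ V-iter (λ m → occursInside⇒occurs (occursInside-V m)) 2 b1 (refl , _ , refl) public

  centers-distinct : ∀ {i j} → i < 2 → j < 2 → mid (iter i V₁) ≡ mid (iter j V₁) → i ≡ j
  centers-distinct {0}           {0}           _             _             _  = refl
  centers-distinct {1}           {1}           _             _             _  = refl
  centers-distinct {0}           {1}           _             _             ()
  centers-distinct {1}           {0}           _             _             ()
  centers-distinct {suc (suc _)} {_}           (s≤s (s≤s ())) _            _
  centers-distinct {_}           {suc (suc _)} _             (s≤s (s≤s ())) _

  alternates : ∀ m → fold cε next m ≡ cε ⊎ fold cε next m ≡ c1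
  alternates zero    = inj₁ refl
  alternates (suc m) with alternates m
  ... | inj₁ e = inj₂ (cong next e)
  ... | inj₂ e = inj₁ (cong next e)

  module CompareU {S : ℕ → Word} {pU} (S-iter : ∀ m → S (suc m) ≡ ⟦ iter m pU ⟧) (V₁≺pU : V₁ ≺[ b0 ] pU) where
    open Compare {S} {pU} S-iter (λ ()) V₁≺pU

    center-S : ∀ m → center (S (suc m)) ≡ word (fold cε next m)
    center-S m = trans (center-iter {S} S-iter m) (cong (λ z → word (fold z next m)) (sym (proj₁ V₁≺pU)))

    center-ε-or-1 : ∀ m → center (S (suc m)) ≡ [] ⊎ center (S (suc m)) ≡ b1 ∷ []
    center-ε-or-1 m with alternates m
    ... | inj₁ e = inj₁ (trans (center-S m) (cong word e))
    ... | inj₂ e = inj₂ (trans (center-S m) (cong word e))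

    lcc-ε : ∀ m → center (S (suc m)) ≡ [] → LongestCommonCentral (S (suc m)) [] (branch 0) (V a b (suc m))
    lcc-ε = branch-lcc-at centers-distinct 0 (s≤s z≤n)

    lcc-1 : ∀ m → center (S (suc m)) ≡ b1 ∷ [] → LongestCommonCentral (S (suc m)) (b1 ∷ []) (branch 1) (V a b (suc m))
    lcc-1 = branch-lcc-at centers-distinct 1 (s≤s (s≤s z≤n))

module CaseI (a b : ℕ) (b+1<a : b + 1 < a) (1≤b : 1 ≤ b) (b-even : 2 ∣ b) (a-odd : ¬ 2 ∣ a) where

  qb : ℕ
  qb = proj₁ (even⇒double b-even)

  b≡ : b ≡ qb + qb
  b≡ = proj₂ (even⇒double b-even)

  pa : ℕ
  pa = proj₁ (odd⇒double+1 a-odd)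

  a≡ : a ≡ pa + suc pa
  a≡ = proj₂ (odd⇒double+1 a-odd)

  qb<pa : qb < pa
  qb<pa = double-<-cancel (s<s⁻¹ (subst₂ _<_ (trans (+-comm b 1) (cong suc b≡)) (trans a≡ (+-suc pa pa)) b+1<a))

  a-split : zeros a ≡ zeros pa ++ word c0 ++ zeros pa
  a-split = trans (cong zeros a≡) (zeros-+ pa (suc pa))

  open EvenB a b (+1<⇒< b+1<a) 1≤b pa qb c0 a-split b≡

  W₁ : Mirror
  W₁ = c0 ⊲ []

  w-half : ℕ → Word
  w-half zero    = []
  w-half (suc m) = zeros pa ++ b1 ∷ grow (w-half m)

  iter-W₁ : ∀ m → iter m W₁ ≡ c0 ⊲ w-half m
  iter-W₁ zero    = refl
  iter-W₁ (suc m) = cong step (iter-W₁ m)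

  W-iter : ∀ m → W a b (suc m) ≡ ⟦ iter m W₁ ⟧
  W-iter = T-iter (W a b) (λ _ → refl) refl

  occurs-W : ∀ m → Occurs ⟦ iter m W₁ ⟧
  occurs-W m = subst Occurs (W-iter m) (occursInside⇒occurs (occursInside-W 1≤b m))

  W₁-period : W₁ ≺[ b0 ] iter 1 W₁
  W₁-period = refl , ⊏-++ʳ {b0} {[]} (zeros-<⇒⊏ {0} {pa} (≤-trans (s≤s z≤n) qb<pa)) (b1 ∷ grow [])

  w-half-⊏ : ∀ m → w-half m ⊏[ b0 ] w-half (suc m)
  w-half-⊏ m = subst₂ (λ p q → half p ⊏[ b0 ] half q) (iter-W₁ m) (trans (iter-comm m 1 W₁) (iter-W₁ (suc m)))
                      (proj₂ (iter-≺ m W₁-period))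

  φ-[0]-split : φ a b (b0 ∷ []) ≡ zeros pa ++ word c0 ++ zeros pa ∷ʳ b1
  φ-[0]-split = trans (φ-[] b0) (trans (cong (_∷ʳ b1) a-split) (++-assoc (zeros pa) (b0 ∷ zeros pa) (b1 ∷ [])))

  gap-of-0-centered : ∀ j h′ → Occurs (mirror c0 (zeros j ++ b1 ∷ h′)) → j ≡ pa
  gap-of-0-centered j h′ occ = odd-run (occurs-gap (j + suc j) (occurs-odd-gap j h′ occ))
    where
    odd-run : (∃ λ c → run c ≡ j + suc j) → j ≡ pa
    odd-run (b0 , a≡j) = double+1-injective (trans (sym a≡j) a≡)
    odd-run (b1 , b≡j) = ⊥-elim (double≢double+1 qb j (trans (sym b≡) b≡j))

  -- By desubstitution, 0^pa 1 φ(g) 0^i comes from the 0-centered palindrome ḡ 0 g, and from 0 ḡ 0 g 0 when i > b.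
  occurs-framed-0 : ∀ g i → Occurs (mirror c0 (zeros pa ++ b1 ∷ φ a b g ++ zeros i)) →
                    Occurs (mirror c0 g) × (b < i → Occurs (mirror c0 (g ∷ʳ b0)))
  occurs-framed-0 g i occ =
    map₂ (λ bordered b<i → subst Occurs (sym (mirror-∷ʳ c0 g b0)) (bordered b<i))
      (occurs-framed i (mirror c0 g) (subst Occurs (mirror-framed c0 pa g i (b0 ∷ []) φ-[0]-split) occ))

  framed-⊑-short : ∀ {g i m} → i ≤ b → g ⊑ w-half m → zeros pa ++ b1 ∷ φ a b g ++ zeros i ⊑ w-half (suc m)
  framed-⊑-short {g} {i} i≤b g⊑ = ⊑-++ˡ (zeros pa) (⊑-++ˡ (b1 ∷ [])
    (⊑-trans (⊑-++ˡ (φ a b g) (subst (zeros i ⊑_) (++-identityʳ (zeros b)) (zeros-≤⇒⊑ i≤b []))) (grow-⊑ g⊑)))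

  framed-⊑-long : ∀ {g i m} → i ≤ a → g ∷ʳ b0 ⊑ w-half m → zeros pa ++ b1 ∷ φ a b g ++ zeros i ⊑ w-half (suc m)
  framed-⊑-long {g} {i} {m} i≤a (s , e) = ⊑-++ˡ (zeros pa) (⊑-++ˡ (b1 ∷ [])
    (subst (φ a b g ++ zeros i ⊑_) (sym grow≡) (⊑-++ˡ (φ a b g) (zeros-≤⇒⊑ i≤a (b1 ∷ φ a b s ++ zeros b)))))
    where
    open ≡-Reasoning
    grow≡ : grow (w-half m) ≡ φ a b g ++ zeros a ++ b1 ∷ φ a b s ++ zeros b
    grow≡ = begin
      φ a b (w-half m) ++ zeros b                       ≡⟨ cong (λ t → φ a b t ++ zeros b) (trans e (++-assoc g (b0 ∷ []) s)) ⟩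
      φ a b (g ++ b0 ∷ s) ++ zeros b
        ≡⟨ cong (_++ zeros b) (trans (φ-++ g (b0 ∷ s)) (cong (φ a b g ++_) (φ-∷ b0 s))) ⟩
      (φ a b g ++ zeros a ++ b1 ∷ φ a b s) ++ zeros b
        ≡⟨ solve 5 (λ G A l S B → (G ⊕ A ⊕ l ⊕ S) ⊕ B ⊜ G ⊕ A ⊕ l ⊕ S ⊕ B) refl
             (φ a b g) (zeros a) (b1 ∷ []) (φ a b s) (zeros b) ⟩
      φ a b g ++ zeros a ++ b1 ∷ φ a b s ++ zeros b     ∎

  mirror-0-in-W′ : ∀ n h → length h ≤ n → Occurs (mirror c0 h) → ∃ λ m → h ⊑ w-half m
  mirror-0-in-W′ zero    []      _    _   = 0 , ⊑-refl []
  mirror-0-in-W′ zero    (_ ∷ _) ()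
  mirror-0-in-W′ (suc n) h       |h|≤ occ with split-leading-zeros h
  ... | inj₁ eh = 1 , subst (_⊑ w-half 1) (sym eh) (zeros-≤⇒⊑ L≤pa (b1 ∷ grow []))
    where
    L = length h
    L≤pa : L ≤ pa
    L≤pa = double+1-≤-cancel (subst (L + suc L ≤_) a≡
             (occurs-zeros (L + suc L) (subst Occurs (trans (cong (mirror c0) eh) (mirror-zeros-0 L)) occ)))
  ... | inj₂ (j , h′ , refl) =
    after-1 (gap-of-0-centered j h′ occ) (occurs-after-1 (zeros j) h′ (occurs-infix (half-infix c0 _) occ))
    where
    after-1 : j ≡ pa → (∃₂ λ g i → h′ ≡ φ a b g ++ zeros i) → ∃ λ m → zeros j ++ b1 ∷ h′ ⊑ w-half m
    after-1 refl (g , i , refl) = by-length (i ≤? b) (occurs-framed-0 g i occ)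
      where
      inner≤n : length (φ a b g) + i ≤ n
      inner≤n = s≤s⁻¹ (≤-trans (m≤n+m _ pa) (subst (_≤ suc n) (length-framed-half pa g i) |h|≤))
      by-length : Dec (i ≤ b) → Occurs (mirror c0 g) × (b < i → Occurs (mirror c0 (g ∷ʳ b0))) →
                  ∃ λ m → zeros pa ++ b1 ∷ φ a b g ++ zeros i ⊑ w-half m
      by-length (yes i≤b) (occ-g , _) = map suc (λ {m} → framed-⊑-short {m = m} i≤b) (mirror-0-in-W′ n g |g|≤n occ-g)
        where
        |g|≤n : length g ≤ n
        |g|≤n = ≤-trans (length-φ≥ g) (≤-trans (m≤m+n _ i) inner≤n)
      by-length (no i≰b) (_ , occ-g0) =
        map suc (λ {m} → framed-⊑-long {m = m} (occurs-framed-zeros pa g i (occurs-infix (half-infix c0 _) occ)))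
          (mirror-0-in-W′ n (g ∷ʳ b0) |g0|≤n (occ-g0 (≰⇒> i≰b)))
        where
        |g0|≤n : length (g ∷ʳ b0) ≤ n
        |g0|≤n = ≤-trans (≤-reflexive (trans (length-∷ʳ g b0) (+-comm 1 (length g))))
                   (≤-trans (+-mono-≤ (length-φ≥ g) (≤-trans 1≤b (<⇒≤ (≰⇒> i≰b)))) inner≤n)

  mirror-0-in-W : ∀ h → Occurs (mirror c0 h) → ∃ λ m → h ⊑ w-half m
  mirror-0-in-W h = mirror-0-in-W′ (length h) h ≤-refl

  -- A 0-centered palindrome is a central factor of some W^(m), hence extends to a palindrome inside W^(m+1).
  mirror-0-extends : ∀ h → Occurs (mirror c0 h) → ∃ λ c → Occurs (c ∷ mirror c0 h ∷ʳ c)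
  mirror-0-extends h occ = extend (mirror-0-in-W h occ)
    where
    extend : (∃ λ m → h ⊑ w-half m) → ∃ λ c → Occurs (c ∷ mirror c0 h ∷ʳ c)
    extend (m , h⊑) = next-letter (⊑∧length<⇒⊏ (⊑-trans h⊑ (⊏⇒⊑ (w-half-⊏ m)))
                                                (≤-trans (s≤s (⊑⇒length≤ h⊑)) (⊏⇒length< (w-half-⊏ m))))
      where
      next-letter : (∃ λ c → h ⊏[ c ] w-half (suc m)) → ∃ λ c → Occurs (c ∷ mirror c0 h ∷ʳ c)
      next-letter (c , h⊏) = c , subst Occurs (mirror-∷ʳ c0 h c)
        (occurs-infix (centralFactor⇒infix (⊑⇒centralFactor c0 (⊏⇒∷ʳ⊑ h⊏)))
          (subst Occurs (cong ⟦_⟧ (iter-W₁ (suc m))) (occurs-W (suc m))))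

  maximal⇒center≢0 : ∀ p → MaximalPalindrome a b p → center p ≢ b0 ∷ []
  maximal⇒center≢0 p max@(factor , pal , _) center≡ = as-mirror (palindrome⇒mirror p pal)
    where
    as-mirror : (∃₂ λ z h → p ≡ mirror z h) → ⊥
    as-mirror (z , h , refl) with refl ← word-injective {z} {c0} (trans (sym (center-mirror z h)) center≡) =
      let c , occ = mirror-0-extends h (factor⇒occurs factor) in maximal⇒¬extends max c (occurs⇒factor occ)

  module BW = Branches (W a b) W₁ W-iter (λ m → occursInside⇒occurs (occursInside-W 1≤b m)) 1 b0 W₁-period

  U₁ : Mirror
  U₁ = cε ⊲ zeros pa

  U-iter : ∀ m → U a b (suc m) ≡ ⟦ iter m U₁ ⟧
  U-iter = T-iter (U a b) (λ _ → refl) (trans (cong (λ n → zeros (n ∸ 1)) (trans a≡ (+-suc pa pa))) (sym (mirror-zeros-ε pa)))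

  open CompareU {U a b} U-iter (refl , zeros-<⇒⊏ qb<pa)

  result : Σ (ℕ → Bit) λ vε → Σ (ℕ → Bit) λ v1 → Σ (ℕ → Bit) λ v0 →
      (IsBranch a b [] vε × IsBidiLimit (λ n → V a b (2 * n + 1)) [] vε)
    × (IsBranch a b (b1 ∷ []) v1 × IsBidiLimit (λ n → V a b (2 * n + 2)) (b1 ∷ []) v1)
    × (IsBranch a b (b0 ∷ []) v0 × IsBidiLimit (λ n → W a b (n + 1)) (b0 ∷ []) v0)
    × (∀ n → 1 ≤ n → center (U a b n) ≡ [] ⊎ center (U a b n) ≡ b1 ∷ [])
    × (∀ n → 1 ≤ n → center (U a b n) ≡ [] → LongestCommonCentral (U a b n) [] vε (V a b n))
    × (∀ n → 1 ≤ n → center (U a b n) ≡ b1 ∷ [] → LongestCommonCentral (U a b n) (b1 ∷ []) v1 (V a b n))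
    × (∀ p → MaximalPalindrome a b p → center p ≢ b0 ∷ [])
  result = branch 0 , branch 1 , BW.branch 0
         , (branch-isBranch 0 , branch-limit 0)
         , (branch-isBranch 1 , branch-limit 1)
         , (BW.branch-isBranch 0 , IsBidiLimit-cong (λ n → cong (λ k → W a b (k + 1)) (*-identityˡ n)) (BW.branch-limit 0))
         , (λ { (suc m) _ → center-ε-or-1 m })
         , (λ { (suc m) _ → lcc-ε m })
         , (λ { (suc m) _ → lcc-1 m })
         , maximal⇒center≢0

module CaseII (a b : ℕ) (b+1<a : b + 1 < a) (1≤b : 1 ≤ b) (a-even : 2 ∣ a) (b-even : 2 ∣ b) where

  qa : ℕ
  qa = proj₁ (even⇒double a-even)

  a≡ : a ≡ qa + qa
  a≡ = proj₂ (even⇒double a-even)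

  qb : ℕ
  qb = proj₁ (even⇒double b-even)

  b≡ : b ≡ qb + qb
  b≡ = proj₂ (even⇒double b-even)

  qb<qa : qb < qa
  qb<qa = double-<-cancel (subst₂ _<_ b≡ a≡ (+1<⇒< b+1<a))

  pu : ℕ
  pu = qa ∸ 1

  qa≡ : qa ≡ suc pu
  qa≡ = sym (m+[n∸m]≡n (≤-trans (s≤s z≤n) qb<qa))

  open EvenB a b (+1<⇒< b+1<a) 1≤b qa qb cε (trans (cong zeros a≡) (zeros-+ qa qa)) b≡

  U₁ : Mirror
  U₁ = c0 ⊲ zeros pu

  U₂-iter : ∀ m → U a b (suc (suc m)) ≡ ⟦ iter m (iter 1 U₁) ⟧
  U₂-iter m = trans (T-iter (U a b) (λ _ → refl) U₁-eq (suc m)) (cong ⟦_⟧ (sym (iter-comm m 1 U₁)))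
    where
    U₁-eq : zeros (a ∸ 1) ≡ mirror c0 (zeros pu)
    U₁-eq = trans (cong (λ n → zeros (n ∸ 1)) (trans a≡ (cong (λ q → q + q) qa≡))) (sym (mirror-zeros-0 pu))

  open CompareU {λ m → U a b (suc m)} U₂-iter (refl , ⊏-++ʳ (zeros-<⇒⊏ qb<qa) (b1 ∷ grow (zeros pu)))
  open EvenRuns qa qb a≡ b≡

  result : Σ (ℕ → Bit) λ vε → Σ (ℕ → Bit) λ v1 →
      (IsBranch a b [] vε × IsBidiLimit (λ n → V a b (2 * n + 1)) [] vε)
    × (IsBranch a b (b1 ∷ []) v1 × IsBidiLimit (λ n → V a b (2 * n + 2)) (b1 ∷ []) v1)
    × (¬ (∃ λ v → IsBranch a b (b0 ∷ []) v))
    × (∀ n → 2 ≤ n → center (U a b n) ≡ [] ⊎ center (U a b n) ≡ b1 ∷ [])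
    × (∀ n → 2 ≤ n → center (U a b n) ≡ [] → LongestCommonCentral (U a b n) [] vε (V a b (n ∸ 1)))
    × (∀ n → 2 ≤ n → center (U a b n) ≡ b1 ∷ [] → LongestCommonCentral (U a b n) (b1 ∷ []) v1 (V a b (n ∸ 1)))
  result = branch 0 , branch 1
         , (branch-isBranch 0 , branch-limit 0)
         , (branch-isBranch 1 , branch-limit 1)
         , bounded-halves⇒¬branch c0 a occurs-mirror-0
         , (λ { (suc (suc m)) _ → center-ε-or-1 m ; (suc zero) (s≤s ()) })
         , (λ { (suc (suc m)) _ → lcc-ε m ; (suc zero) (s≤s ()) })
         , (λ { (suc (suc m)) _ → lcc-1 m ; (suc zero) (s≤s ()) })

-- The orbit of V^(1) = 0^b runs through the centers 0, ε, 1.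

module CaseIII (a b : ℕ) (b+1<a : b + 1 < a) (1≤b : 1 ≤ b) (b-odd : ¬ 2 ∣ b) (a-even : 2 ∣ a) where

  qa : ℕ
  qa = proj₁ (even⇒double a-even)

  a≡ : a ≡ qa + qa
  a≡ = proj₂ (even⇒double a-even)

  qb : ℕ
  qb = proj₁ (odd⇒double+1 b-odd)

  b≡ : b ≡ qb + suc qb
  b≡ = proj₂ (odd⇒double+1 b-odd)

  pu : ℕ
  pu = qa ∸ 1

  qa≡ : qa ≡ suc pu
  qa≡ = sym (m+[n∸m]≡n (double-<-cancel (subst (0 <_) a≡ (≤-trans (s≤s z≤n) (+1<⇒< b+1<a)))))

  qb<pu : qb < pu
  qb<pu = double-<-cancel (s<s⁻¹ (s<s⁻¹ (subst₂ _<_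
    (trans (cong (_+ 1) b≡) (trans (+-comm _ 1) (cong suc (+-suc qb qb))))
    (trans a≡ (trans (cong (λ q → q + q) qa≡) (cong suc (+-suc pu pu))))
    b+1<a)))

  open Iteration a b (+1<⇒< b+1<a) 1≤b qa qb cε c0
    (trans (cong zeros a≡) (zeros-+ qa qa)) (trans (cong zeros b≡) (zeros-+ qb (suc qb)))

  V₁ : Mirror
  V₁ = c0 ⊲ zeros qb

  V-iter : ∀ m → V a b (suc m) ≡ ⟦ iter m V₁ ⟧
  V-iter = T-iter (V a b) (λ _ → refl) (trans (cong zeros b≡) (sym (mirror-zeros-0 qb)))

  open Branches (V a b) V₁ V-iter (λ m → occursInside⇒occurs (occursInside-V m)) 3 b1 (refl , _ , refl)

  U₁ : Mirror
  U₁ = c0 ⊲ zeros pu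

  U-iter : ∀ m → U a b (suc m) ≡ ⟦ iter m U₁ ⟧
  U-iter = T-iter (U a b) (λ _ → refl)
    (trans (cong (λ n → zeros (n ∸ 1)) (trans a≡ (cong (λ q → q + q) qa≡))) (sym (mirror-zeros-0 pu)))

  open Compare {U a b} U-iter (λ ()) (refl , zeros-<⇒⊏ qb<pu)

  centers-distinct : ∀ {i j} → i < 3 → j < 3 → mid (iter i V₁) ≡ mid (iter j V₁) → i ≡ j
  centers-distinct {0} {0} _ _ _  = refl
  centers-distinct {1} {1} _ _ _  = refl
  centers-distinct {2} {2} _ _ _  = refl
  centers-distinct {0} {1} _ _ ()
  centers-distinct {0} {2} _ _ ()
  centers-distinct {1} {0} _ _ ()
  centers-distinct {1} {2} _ _ ()
  centers-distinct {2} {0} _ _ ()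
  centers-distinct {2} {1} _ _ ()
  centers-distinct {suc (suc (suc _))} {_} (s≤s (s≤s (s≤s ()))) _ _
  centers-distinct {_} {suc (suc (suc _))} _ (s≤s (s≤s (s≤s ()))) _

  lcc-at : ∀ r → r < 3 → ∀ n → 1 ≤ n → center (U a b n) ≡ word (mid (iter r V₁)) →
           LongestCommonCentral (U a b n) (word (mid (iter r V₁))) (branch r) (V a b n)
  lcc-at r r<3 (suc m) _ = branch-lcc-at centers-distinct r r<3 m

  result : Σ (ℕ → Bit) λ v0 → Σ (ℕ → Bit) λ vε → Σ (ℕ → Bit) λ v1 →
      (IsBranch a b (b0 ∷ []) v0 × IsBidiLimit (λ n → V a b (3 * n + 1)) (b0 ∷ []) v0)
    × (IsBranch a b [] vε × IsBidiLimit (λ n → V a b (3 * n + 2)) [] vε)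
    × (IsBranch a b (b1 ∷ []) v1 × IsBidiLimit (λ n → V a b (3 * n + 3)) (b1 ∷ []) v1)
    × (∀ n → 1 ≤ n → center (U a b n) ≡ b0 ∷ [] → LongestCommonCentral (U a b n) (b0 ∷ []) v0 (V a b n))
    × (∀ n → 1 ≤ n → center (U a b n) ≡ [] → LongestCommonCentral (U a b n) [] vε (V a b n))
    × (∀ n → 1 ≤ n → center (U a b n) ≡ b1 ∷ [] → LongestCommonCentral (U a b n) (b1 ∷ []) v1 (V a b n))
  result = branch 0 , branch 1 , branch 2
         , (branch-isBranch 0 , branch-limit 0)
         , (branch-isBranch 1 , branch-limit 1)
         , (branch-isBranch 2 , branch-limit 2)
         , lcc-at 0 (s≤s z≤n)
         , lcc-at 1 (s≤s (s≤s z≤n))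
         , lcc-at 2 (s≤s (s≤s (s≤s z≤n)))

-- T preserves the center 0, and the half of V^(n+1) extends that of V^(n) by 0.

module CaseIV (a b : ℕ) (b+1<a : b + 1 < a) (1≤b : 1 ≤ b) (a-odd : ¬ 2 ∣ a) (b-odd : ¬ 2 ∣ b) where

  qa : ℕ
  qa = proj₁ (odd⇒double+1 a-odd)

  a≡ : a ≡ qa + suc qa
  a≡ = proj₂ (odd⇒double+1 a-odd)

  qb : ℕ
  qb = proj₁ (odd⇒double+1 b-odd)

  b≡ : b ≡ qb + suc qb
  b≡ = proj₂ (odd⇒double+1 b-odd)

  qb<qa : qb < qa
  qb<qa = double-<-cancel (s<s⁻¹ (subst₂ _<_ (trans b≡ (+-suc qb qb)) (trans a≡ (+-suc qa qa)) (+1<⇒< b+1<a)))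

  open Iteration a b (+1<⇒< b+1<a) 1≤b qa qb c0 c0
    (trans (cong zeros a≡) (zeros-+ qa (suc qa))) (trans (cong zeros b≡) (zeros-+ qb (suc qb)))

  V₁ : Mirror
  V₁ = c0 ⊲ zeros qb

  V-iter : ∀ m → V a b (suc m) ≡ ⟦ iter m V₁ ⟧
  V-iter = T-iter (V a b) (λ _ → refl) (trans (cong zeros b≡) (sym (mirror-zeros-0 qb)))

  open Branches (V a b) V₁ V-iter (λ m → occursInside⇒occurs (occursInside-V m)) 1 b0
    (refl , ⊏-++ʳ (zeros-<⇒⊏ qb<qa) (b1 ∷ grow (zeros qb)))

  U₁ : Mirror
  U₁ = cε ⊲ zeros qa

  U₃-iter : ∀ m → U a b (suc (suc (suc m))) ≡ ⟦ iter m (iter 2 U₁) ⟧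
  U₃-iter m = trans (T-iter (U a b) (λ _ → refl) U₁-eq (suc (suc m))) (cong ⟦_⟧ (sym (iter-comm m 2 U₁)))
    where
    U₁-eq : zeros (a ∸ 1) ≡ mirror cε (zeros qa)
    U₁-eq = trans (cong (λ n → zeros (n ∸ 1)) (trans a≡ (+-suc qa qa))) (sym (mirror-zeros-ε qa))

  open Compare {λ m → U a b (suc (suc m))} U₃-iter (λ ()) (refl , _ , refl)

  c0-fixed : ∀ m → fold c0 next m ≡ c0
  c0-fixed zero    = refl
  c0-fixed (suc m) = cong next (c0-fixed m)

  lcc-0 : ∀ n → 3 ≤ n → center (U a b n) ≡ b0 ∷ [] × LongestCommonCentral (U a b n) (b0 ∷ []) (branch 0) (V a b (n ∸ 2))
  lcc-0 (suc (suc (suc m))) _ = center-U , branch-lcc-at single 0 (s≤s z≤n) m center-U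
    where
    center-U : center (U a b (suc (suc (suc m)))) ≡ b0 ∷ []
    center-U = trans (center-iter {λ m → U a b (suc (suc m))} U₃-iter m) (cong word (c0-fixed m))
    single : ∀ {i j} → i < 1 → j < 1 → mid (iter i V₁) ≡ mid (iter j V₁) → i ≡ j
    single (s≤s z≤n) (s≤s z≤n) _ = refl
  lcc-0 (suc zero)       (s≤s ())
  lcc-0 (suc (suc zero)) (s≤s (s≤s ()))

  open OddRuns qa qb a≡ b≡

  result : Σ (ℕ → Bit) λ v0 →
      (IsBranch a b (b0 ∷ []) v0 × IsBidiLimit (λ n → V a b (n + 1)) (b0 ∷ []) v0)
    × (¬ (∃ λ v → IsBranch a b [] v))
    × (¬ (∃ λ v → IsBranch a b (b1 ∷ []) v))
    × (∀ n → 3 ≤ n → center (U a b n) ≡ b0 ∷ [] × LongestCommonCentral (U a b n) (b0 ∷ []) v0 (V a b (n ∸ 2)))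
  result = branch 0
         , (branch-isBranch 0 , IsBidiLimit-cong (λ n → cong (λ k → V a b (k + 1)) (*-identityˡ n)) (branch-limit 0))
         , bounded-halves⇒¬branch cε a occurs-mirror-ε
         , bounded-halves⇒¬branch c1 _ occurs-mirror-1
         , lcc-0

proposition5p16 : (a b : ℕ) → b + 1 < a → 1 ≤ b →
    -- (i) b even, a odd
    ((2 ∣ b) → ¬ (2 ∣ a) →
      Σ (ℕ → Bit) λ vε → Σ (ℕ → Bit) λ v1 → Σ (ℕ → Bit) λ v0 →
        (IsBranch a b [] vε × IsBidiLimit (λ n → V a b (2 * n + 1)) [] vε)
        × (IsBranch a b (b1 ∷ []) v1 × IsBidiLimit (λ n → V a b (2 * n + 2)) (b1 ∷ []) v1)
        × (IsBranch a b (b0 ∷ []) v0 × IsBidiLimit (λ n → W a b (n + 1)) (b0 ∷ []) v0)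
        × (∀ n → 1 ≤ n → center (U a b n) ≡ [] ⊎ center (U a b n) ≡ b1 ∷ [])
        × (∀ n → 1 ≤ n → center (U a b n) ≡ [] → LongestCommonCentral (U a b n) [] vε (V a b n))
        × (∀ n → 1 ≤ n → center (U a b n) ≡ b1 ∷ [] → LongestCommonCentral (U a b n) (b1 ∷ []) v1 (V a b n))
        × (∀ p → MaximalPalindrome a b p → center p ≢ b0 ∷ []))
    -- (ii) a and b even
    × ((2 ∣ a) → (2 ∣ b) →
      Σ (ℕ → Bit) λ vε → Σ (ℕ → Bit) λ v1 →
        (IsBranch a b [] vε × IsBidiLimit (λ n → V a b (2 * n + 1)) [] vε)
        × (IsBranch a b (b1 ∷ []) v1 × IsBidiLimit (λ n → V a b (2 * n + 2)) (b1 ∷ []) v1)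
        × (¬ (∃ λ v → IsBranch a b (b0 ∷ []) v))
        × (∀ n → 2 ≤ n → center (U a b n) ≡ [] ⊎ center (U a b n) ≡ b1 ∷ [])
        × (∀ n → 2 ≤ n → center (U a b n) ≡ [] → LongestCommonCentral (U a b n) [] vε (V a b (n ∸ 1)))
        × (∀ n → 2 ≤ n → center (U a b n) ≡ b1 ∷ [] → LongestCommonCentral (U a b n) (b1 ∷ []) v1 (V a b (n ∸ 1))))
    -- (iii) b odd, a even
    × (¬ (2 ∣ b) → (2 ∣ a) →
      Σ (ℕ → Bit) λ v0 → Σ (ℕ → Bit) λ vε → Σ (ℕ → Bit) λ v1 →
        (IsBranch a b (b0 ∷ []) v0 × IsBidiLimit (λ n → V a b (3 * n + 1)) (b0 ∷ []) v0)
        × (IsBranch a b [] vε × IsBidiLimit (λ n → V a b (3 * n + 2)) [] vε)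
        × (IsBranch a b (b1 ∷ []) v1 × IsBidiLimit (λ n → V a b (3 * n + 3)) (b1 ∷ []) v1)
        × (∀ n → 1 ≤ n → center (U a b n) ≡ b0 ∷ [] → LongestCommonCentral (U a b n) (b0 ∷ []) v0 (V a b n))
        × (∀ n → 1 ≤ n → center (U a b n) ≡ [] → LongestCommonCentral (U a b n) [] vε (V a b n))
        × (∀ n → 1 ≤ n → center (U a b n) ≡ b1 ∷ [] → LongestCommonCentral (U a b n) (b1 ∷ []) v1 (V a b n)))
    -- (iv) a and b odd
    × (¬ (2 ∣ a) → ¬ (2 ∣ b) →
      Σ (ℕ → Bit) λ v0 →
        (IsBranch a b (b0 ∷ []) v0 × IsBidiLimit (λ n → V a b (n + 1)) (b0 ∷ []) v0)
        × (¬ (∃ λ v → IsBranch a b [] v))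
        × (¬ (∃ λ v → IsBranch a b (b1 ∷ []) v))
        × (∀ n → 3 ≤ n → center (U a b n) ≡ b0 ∷ [] × LongestCommonCentral (U a b n) (b0 ∷ []) v0 (V a b (n ∸ 2))))
proposition5p16 a b b+1<a 1≤b =
    CaseI.result   a b b+1<a 1≤b
  , CaseII.result  a b b+1<a 1≤b
  , CaseIII.result a b b+1<a 1≤b
  , CaseIV.result  a b b+1<a 1≤b
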